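{- Let $\theta<\omega^\omega$ be an ordinal, let $k\ge1$ and $l_1<\dots<l_k<\mathrm{CB}(\theta)$ be natural numbers, and let $A_1,\dots,A_k$ be sets with $A_i\in\mathcal{L}(\theta)_{l_i}$. Then there exists $X\subseteq\bigcup_{i=1}^kA_i$, closed in its supremum, with $\mathrm{otp}(X)=\omega^k$. Moreover, $X$ can be chosen such that $\pi_X[X\cap F]\in\mathcal{L}(\omega^k)_{i-1}$ for every $1\le i\le k$ and every $F\in\mathcal{L}(\theta)_{l_i}$.
   Context: All ordinals are $<\omega^\omega$. For a nonzero ordinal $\alpha$ with Cantor normal form $\alpha=\omega^{\gamma_1}\cdot m_1+\dots+\omega^{\gamma_l}\cdot m_l$ ($\gamma_1>\dots>\gamma_l$, $m_i\ge 1$), set $\mathrm{CB}(\alpha)=\gamma_l$ and $p(\alpha)=m_l$; by convention $\mathrm{CB}(0)=0$ and $p(n)=n+1$ for every natural number $n$. Tree order: $\beta\sqsubset\alpha$ iff $\alpha=\beta+\omega^{\gamma}$ for some nonzero ordinal $\gamma>\mathrm{CB}(\beta)$. $T(\alpha)=\{\alpha\}\cup\{\beta:\beta\sqsubset\alpha\}$ and $T_{=n}(\alpha)=\{\beta\sqsubset\alpha:\mathrm{CB}(\beta)=n\}$. For a set of ordinals $I$, $\pi_I$ is the unique order-preserving bijection from $I$ onto its order type $\mathrm{otp}(I)$. A set of ordinals $X$ is closed in its supremum if it is a closed subset of $\sup X$ in the order topology. Large sets: for natural numbers $k,r$, let $F(\omega^k)^r_k=\{\omega^k\}$ and for $n<k$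 let $F(\omega^k)^r_n$ be the set of $\beta\in T_{=n}(\omega^k)$ such that $p(\beta)>r$ and $p(\beta')>r$ for every $\beta'$ with $\beta\sqsubset\beta'\sqsubset\omega^k$. For any $\alpha$ with $\mathrm{CB}(\alpha)=k$, $T(\alpha)$ has order type $\omega^k+1$, and for $n\le k$ put $F(\alpha)^r_n=\pi_{T(\alpha)}^{ -1}[F(\omega^k)^r_n]$. For $n\le\mathrm{CB}(\alpha)$ let $\mathcal{L}(\alpha)^r_n=\{A\subseteq T_{=n}(\alpha):F(\alpha)^r_n\subseteq A\}$ and $\mathcal{L}(\alpha)_n=\bigcup_{r\in\mathbb{N}}\mathcal{L}(\alpha)^r_n$. -}

module Defs where

open import Data.Nat using (ℕ; zero; suc; _<_; _≤_; _≥_; _≟_; _≤?_)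
open import Data.Bool using (Bool; true; false; if_then_else_)
open import Data.List using (List; []; _∷_; _++_; [_]; length; takeWhile; filter)
open import Data.List.Relation.Unary.Linked using (Linked; [-])
open import Data.Product using (Σ; _×_; _,_)
open import Data.Sum using (_⊎_)
open import Data.Empty using (⊥)
open import Data.Unit using (⊤)
open import Relation.Binary.PropositionalEquality using (_≡_)

-- Ordinals < ω^ω in Cantor normal form:
-- α = ω^{e₁} + ω^{e₂} + … + ω^{eₘ} with e₁ ≥ e₂ ≥ … ≥ eₘ
-- (exponents repeated according to multiplicity); 0 is the empty list.
record Ord : Set where
  constructor mkOrd
  field
    exps   : List ℕ
    sorted : Linked _≥_ exps
open Ord public

ltL : List ℕ → List ℕ → Set
ltL [] [] = ⊥
ltL [] (_ ∷ _) = ⊤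
ltL (_ ∷ _) [] = ⊥
ltL (x ∷ xs) (y ∷ ys) = (x < y) ⊎ ((x ≡ y) × ltL xs ys)

infix 4 _<ₒ_ _≤ₒ_
_<ₒ_ : Ord → Ord → Set
α <ₒ β = ltL (exps α) (exps β)

_≤ₒ_ : Ord → Ord → Set
α ≤ₒ β = (α <ₒ β) ⊎ (α ≡ β)

ωpow : ℕ → Ord
ωpow k = mkOrd [ k ] [-]

lastL : List ℕ → ℕ
lastL [] = 0
lastL (x ∷ []) = x
lastL (x ∷ y ∷ ys) = lastL (y ∷ ys)

-- CB(α) = γ_l (smallest exponent), CB(0) = 0
CB : Ord → ℕ
CB α = lastL (exps α)

finL : List ℕ → Bool
finL [] = true
finL (zero ∷ _) = true
finL (suc _ ∷ _) = false

-- p(α) = m_l (multiplicity of the smallest exponent); p(n) = n+1 for n ∈ ℕ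
p : Ord → ℕ
p α = if finL (exps α) then suc (length (exps α))
      else length (filter (_≟ lastL (exps α)) (exps α))

-- CNF exponent list of α + ω^γ
addωL : List ℕ → ℕ → List ℕ
addωL xs γ = takeWhile (γ ≤?_) xs ++ [ γ ]

infix 4 _⊏_
_⊏_ : Ord → Ord → Set
β ⊏ α = Σ ℕ λ γ → (1 ≤ γ) × (CB β < γ) × (exps α ≡ addωL (exps β) γ)

T : Ord → Ord → Set
T α β = (β ≡ α) ⊎ (β ⊏ α)

T= : Ord → ℕ → Ord → Set
T= α n β = (β ⊏ α) × (CB β ≡ n)

OrdIso : (Ord → Set) → (Ord → Set) → (Ord → Ord) → Set
OrdIso I J f =
  (∀ x → I x → J (f x)) ×
  (∀ x y → I x → I y → x <ₒ y → f x <ₒ f y) ×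
  (∀ y → J y → Σ Ord λ x → I x × (f x ≡ y))

-- F(ω^k)^r_n  (meaningful for n ≤ k)
Fω : ℕ → ℕ → ℕ → Ord → Set
Fω k r n β =
  ((n < k) × T= (ωpow k) n β × (r < p β) ×
     (∀ β' → β ⊏ β' → β' ⊏ ωpow k → r < p β'))
  ⊎ ((n ≡ k) × (β ≡ ωpow k))

-- F(α)^r_n = π_{T(α)}^{-1}[F(ω^k)^r_n], k = CB(α),
-- where π_{T(α)} : T(α) → ω^k+1 = {δ : δ ≤ ω^k} is the order isomorphism
F : Ord → ℕ → ℕ → Ord → Set
F α r n β = Σ (Ord → Ord) λ π →
  OrdIso (T α) (λ δ → δ ≤ₒ ωpow (CB α)) π × T α β × Fω (CB α) r n (π β)

_⊆_ : (Ord → Set) → (Ord → Set) → Set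
A ⊆ B = ∀ x → A x → B x

L : Ord → ℕ → (Ord → Set) → Set
L α n A = Σ ℕ λ r → (A ⊆ T= α n) × (F α r n ⊆ A)

-- X is closed in sup X: every λ < sup X that lies in the closure of X
-- (every neighbourhood (β, λ], β < λ, meets X; λ = 0 is isolated) belongs to X
ClosedInSup : (Ord → Set) → Set
ClosedInSup X = ∀ λ' →
  (Σ Ord λ x → X x × (λ' <ₒ x)) →
  (Σ Ord λ β → β <ₒ λ') →
  (∀ β → β <ₒ λ' → Σ Ord λ x → X x × (β <ₒ x) × (x ≤ₒ λ')) →
  X λ'

image : (Ord → Ord) → (Ord → Set) → (Ord → Set) → Ord → Set
image f X G δ = Σ Ord λ x → X x × G x × (f x ≡ δ)

-- Write exps θ = Q ++ [K] with K = CB θ ≥ 1, and put m j = l_j for j < k and m k = K.  Below θ,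
-- T(θ) consists of the Q + μ with μ < ω^K, and π_{T(θ)} essentially forgets Q.  Send δ < ω^k to
-- Q + μ(δ), where μ(δ) records the Cantor digits of δ as multiplicities of exponents: a digit a
-- of ω^j becomes c + a copies of m j, and each exponent strictly between m j and m (j+1) is
-- repeated about as often.  Reading the multiplicities back inverts the map, so the image X has
-- order type ω^k; the coding is continuous at limits, so X is closed; and since every exponent
-- from m (CB δ) up to K occurs at least c − 1 times in μ(δ), p exceeds every r < c along the
-- whole branch above the image of δ, which puts it into F(θ)^r_{m (CB δ)}.  The same count with
-- the multiplicities forced by F(ω^k)^r_{i-1} sends that set into F(θ)^r_{l_i}, and choosing c
-- above the r of all the A_i gives X ⊆ ⋃ A_i.

module Submission where

open import Defs
open import Data.Nat using (ℕ; _<_; _≤_)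
open import Data.Fin using (Fin; toℕ)
open import Data.Fin as Fin using ()
open import Data.Product using (Σ; _×_)

open import Data.Nat using (zero; suc; _+_; _∸_; _≥_; _≟_; _≤?_; _<?_; _≡ᵇ_; _⊔_; z≤n; s≤s)
open import Data.Nat.Properties
open import Data.Fin using (fromℕ<)
open import Data.Fin.Properties using (toℕ<n; toℕ-fromℕ<; fromℕ<-toℕ)
open import Data.Product using (_,_; proj₁; proj₂; map₁)
open import Data.Sum using (_⊎_; inj₁; inj₂)
open import Data.Empty using (⊥; ⊥-elim)
open import Data.Unit using (⊤; tt)
open import Data.Bool using (true; false; if_then_else_)
open import Data.List using (List; []; _∷_; _++_; [_]; length; filter; replicate; drop; takeWhile; dropWhile; initLast; _∷ʳ′_)
open import Data.List.Properties using (++-assoc; ++-identityʳ; ∷ʳ-injective; length-++; filter-++; filter-accept; filter-reject; filter-none; takeWhile++dropWhile)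
import Data.List.Properties as List
open import Data.List.Relation.Unary.Linked using (Linked; []; [-]; _∷_)
open import Data.List.Relation.Unary.All as All using (All; []; _∷_)
open import Data.List.Relation.Unary.All.Properties using (++⁺; ++⁻ʳ; replicate⁺; all-head-dropWhile; all-takeWhile; takeWhile⁺)
import Data.Maybe.Relation.Unary.All as Maybe
open import Function using (_$_)
open import Induction.WellFounded using (Acc; acc; WellFounded)
open import Relation.Binary.Definitions using (tri<; tri≈; tri>)
open import Relation.Binary.PropositionalEquality hiding ([_])
open import Relation.Nullary using (¬_; yes; no)
open import Relation.Nullary.Decidable using (dec-true; dec-false)

-- Lexicographic order and well-foundedness

ltL-irrefl : ∀ xs → ¬ ltL xs xs
ltL-irrefl (x ∷ xs) (inj₁ x<x) = <-irrefl refl x<x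
ltL-irrefl (x ∷ xs) (inj₂ (_ , h)) = ltL-irrefl xs h

ltL-trans : ∀ xs ys zs → ltL xs ys → ltL ys zs → ltL xs zs
ltL-trans [] (y ∷ ys) (z ∷ zs) _ _ = tt
ltL-trans (x ∷ xs) (y ∷ ys) (z ∷ zs) (inj₁ x<y) (inj₁ y<z) = inj₁ (<-trans x<y y<z)
ltL-trans (x ∷ xs) (y ∷ ys) (z ∷ zs) (inj₁ x<y) (inj₂ (refl , _)) = inj₁ x<y
ltL-trans (x ∷ xs) (y ∷ ys) (z ∷ zs) (inj₂ (refl , _)) (inj₁ y<z) = inj₁ y<z
ltL-trans (x ∷ xs) (y ∷ ys) (z ∷ zs) (inj₂ (refl , p)) (inj₂ (refl , q)) =
  inj₂ (refl , ltL-trans xs ys zs p q)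

ltL-asym : ∀ xs ys → ltL xs ys → ¬ ltL ys xs
ltL-asym xs ys p q = ltL-irrefl xs (ltL-trans xs ys xs p q)

ltL-trichotomy : ∀ xs ys → ltL xs ys ⊎ xs ≡ ys ⊎ ltL ys xs
ltL-trichotomy [] [] = inj₂ (inj₁ refl)
ltL-trichotomy [] (y ∷ ys) = inj₁ tt
ltL-trichotomy (x ∷ xs) [] = inj₂ (inj₂ tt)
ltL-trichotomy (x ∷ xs) (y ∷ ys) with <-cmp x y
... | tri< x<y _ _ = inj₁ (inj₁ x<y)
... | tri> _ _ y<x = inj₂ (inj₂ (inj₁ y<x))
... | tri≈ _ refl _ with ltL-trichotomy xs ys
...   | inj₁ p = inj₁ (inj₂ (refl , p))
...   | inj₂ (inj₁ refl) = inj₂ (inj₁ refl)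
...   | inj₂ (inj₂ p) = inj₂ (inj₂ (inj₂ (refl , p)))

ltL-++⁺ : ∀ P {xs ys} → ltL xs ys → ltL (P ++ xs) (P ++ ys)
ltL-++⁺ [] p = p
ltL-++⁺ (_ ∷ P) p = inj₂ (refl , ltL-++⁺ P p)

ltL-++⁻ : ∀ P {xs ys} → ltL (P ++ xs) (P ++ ys) → ltL xs ys
ltL-++⁻ [] p = p
ltL-++⁻ (_ ∷ P) (inj₁ x<x) = ⊥-elim (<-irrefl refl x<x)
ltL-++⁻ (_ ∷ P) (inj₂ (_ , p)) = ltL-++⁻ P p

ltL-properPrefix : ∀ P y ys → ltL P (P ++ y ∷ ys)
ltL-properPrefix [] y ys = tt
ltL-properPrefix (_ ∷ P) y ys = inj₂ (refl , ltL-properPrefix P y ys)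

ltL-[]ʳ : ∀ xs → ¬ ltL xs []
ltL-[]ʳ [] ()
ltL-[]ʳ (_ ∷ _) ()

≢[]⇒ltL-[] : ∀ xs → xs ≢ [] → ltL [] xs
≢[]⇒ltL-[] [] xs≢[] = xs≢[] refl
≢[]⇒ltL-[] (_ ∷ _) _ = tt

ltL⇒nonempty : ∀ xs ys → ltL xs ys → ltL [] ys
ltL⇒nonempty [] (_ ∷ _) _ = tt
ltL⇒nonempty (_ ∷ _) (_ ∷ _) _ = tt

LeL : List ℕ → List ℕ → Set
LeL xs ys = ltL xs ys ⊎ xs ≡ ys

LeL-<-trans : ∀ xs ys zs → LeL xs ys → ltL ys zs → ltL xs zs
LeL-<-trans xs ys zs (inj₁ p) q = ltL-trans xs ys zs p q
LeL-<-trans xs ys zs (inj₂ refl) q = q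

<-LeL-trans : ∀ xs ys zs → ltL xs ys → LeL ys zs → ltL xs zs
<-LeL-trans xs ys zs p (inj₁ q) = ltL-trans xs ys zs p q
<-LeL-trans xs ys zs p (inj₂ refl) = p

LeL-trans : ∀ xs ys zs → LeL xs ys → LeL ys zs → LeL xs zs
LeL-trans xs ys zs (inj₁ p) q = inj₁ (<-LeL-trans xs ys zs p q)
LeL-trans xs ys zs (inj₂ refl) q = q

[]-LeL : ∀ xs → LeL [] xs
[]-LeL [] = inj₂ refl
[]-LeL (_ ∷ _) = inj₁ tt

Sorted : List ℕ → Set
Sorted = Linked _≥_

-- For a sorted list xs this says xs < ω^v.
HeadBelow : ℕ → List ℕ → Set
HeadBelow v [] = ⊤
HeadBelow v (x ∷ _) = x < v

Sorted-tail : ∀ {x xs} → Sorted (x ∷ xs) → Sorted xs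
Sorted-tail [-] = []
Sorted-tail (_ ∷ s) = s

HeadBelow-tail : ∀ {x xs} → Sorted (x ∷ xs) → HeadBelow (suc x) xs
HeadBelow-tail [-] = tt
HeadBelow-tail (x≥y ∷ _) = s≤s x≥y

HeadBelow⇒ltL : ∀ {v} xs → HeadBelow v xs → ltL xs [ v ]
HeadBelow⇒ltL [] _ = tt
HeadBelow⇒ltL (x ∷ xs) x<v = inj₁ x<v

ltL⇒HeadBelow : ∀ {v} xs → ltL xs [ v ] → HeadBelow v xs
ltL⇒HeadBelow [] _ = tt
ltL⇒HeadBelow (x ∷ xs) (inj₁ x<v) = x<v
ltL⇒HeadBelow (x ∷ []) (inj₂ (_ , ()))
ltL⇒HeadBelow (x ∷ _ ∷ _) (inj₂ (_ , ()))

Sorted-irrelevant : ∀ {xs} (s t : Sorted xs) → s ≡ t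
Sorted-irrelevant [] [] = refl
Sorted-irrelevant [-] [-] = refl
Sorted-irrelevant (a ∷ s) (b ∷ t) = cong₂ _∷_ (≤-irrelevant a b) (Sorted-irrelevant s t)

exps-injective : ∀ {α β} → exps α ≡ exps β → α ≡ β
exps-injective {mkOrd xs s} {mkOrd .xs t} refl = cong (mkOrd xs) (Sorted-irrelevant s t)

<ₒ-trichotomy : ∀ α β → α <ₒ β ⊎ α ≡ β ⊎ β <ₒ α
<ₒ-trichotomy α β with ltL-trichotomy (exps α) (exps β)
... | inj₁ p = inj₁ p
... | inj₂ (inj₁ e) = inj₂ (inj₁ (exps-injective e))
... | inj₂ (inj₂ p) = inj₂ (inj₂ p)

≤ₒ⇒LeL : ∀ {α β} → α ≤ₒ β → LeL (exps α) (exps β)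
≤ₒ⇒LeL (inj₁ p) = inj₁ p
≤ₒ⇒LeL (inj₂ refl) = inj₂ refl

-- Induction on a strict bound for the leading exponent and, for a fixed leading exponent,
-- on the accessibility of the tail.

private
  acc-zero : ∀ {s} → Acc _<ₒ_ (mkOrd [] s)
  acc-zero = acc λ { {mkOrd [] _} () ; {mkOrd (_ ∷ _) _} () }

  AccBelow : ℕ → Set
  AccBelow x = ∀ β → HeadBelow x (exps β) → Acc _<ₒ_ β

  acc-cons : ∀ x → AccBelow x → ∀ ys (s : Sorted (x ∷ ys)) →
             Acc _<ₒ_ (mkOrd ys (Sorted-tail s)) → Acc _<ₒ_ (mkOrd (x ∷ ys) s)
  acc-cons x below ys s (acc rs) = acc λ
    { {mkOrd [] _} _ → acc-zero
    ; {mkOrd (z ∷ zs) t} (inj₁ z<x) → below (mkOrd (z ∷ zs) t) z<x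
    ; {mkOrd (z ∷ zs) t} (inj₂ (refl , p)) → acc-cons x below zs t (rs {mkOrd zs (Sorted-tail t)} p) }

  acc-headAtMost : ∀ x → AccBelow x → ∀ ys (s : Sorted ys) → HeadBelow (suc x) ys →
                   Acc _<ₒ_ (mkOrd ys s)
  acc-headAtMost x below [] _ _ = acc-zero
  acc-headAtMost x below (y ∷ ys) s (s≤s y≤x) with m≤n⇒m<n∨m≡n y≤x
  ... | inj₁ y<x = below (mkOrd (y ∷ ys) s) y<x
  ... | inj₂ refl = acc-cons y below ys s
                      (acc-headAtMost y below ys (Sorted-tail s) (HeadBelow-tail s))

  acc-headBelow : ∀ x → AccBelow x
  acc-headBelow zero (mkOrd [] _) _ = acc-zero
  acc-headBelow (suc x) (mkOrd ys s) = acc-headAtMost x (acc-headBelow x) ys s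

<ₒ-wellFounded : WellFounded _<ₒ_
<ₒ-wellFounded (mkOrd [] _) = acc-zero
<ₒ-wellFounded (mkOrd (y ∷ ys) s) = acc-headBelow (suc y) (mkOrd (y ∷ ys) s) ≤-refl

Sorted⇒All< : ∀ {v xs} → Sorted xs → HeadBelow v xs → All (_< v) xs
Sorted⇒All< [] _ = []
Sorted⇒All< [-] x<v = x<v ∷ []
Sorted⇒All< (x≥y ∷ s) x<v = x<v ∷ Sorted⇒All< s (≤-<-trans x≥y x<v)

All<⇒HeadBelow : ∀ {v xs} → All (_< v) xs → HeadBelow v xs
All<⇒HeadBelow [] = tt
All<⇒HeadBelow (x<v ∷ _) = x<v

HeadBelow-++ : ∀ {v} xs ys → HeadBelow v xs → HeadBelow v ys → HeadBelow v (xs ++ ys)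
HeadBelow-++ [] ys _ h = h
HeadBelow-++ (x ∷ xs) ys h _ = h

HeadBelow-mono : ∀ {v w} xs → v ≤ w → HeadBelow v xs → HeadBelow w xs
HeadBelow-mono [] _ _ = tt
HeadBelow-mono (x ∷ xs) v≤w x<v = <-≤-trans x<v v≤w

HeadBelow-++⁻ˡ : ∀ {v} xs {ys} → HeadBelow v (xs ++ ys) → HeadBelow v ys → HeadBelow v xs
HeadBelow-++⁻ˡ [] _ _ = tt
HeadBelow-++⁻ˡ (x ∷ xs) h _ = h

Sorted-++ : ∀ {v} xs ys → Sorted xs → Sorted ys → All (v ≤_) xs → HeadBelow (suc v) ys →
            Sorted (xs ++ ys)
Sorted-++ [] ys _ t _ _ = t
Sorted-++ (x ∷ []) [] _ _ _ _ = [-]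
Sorted-++ (x ∷ []) (y ∷ ys) _ t (v≤x ∷ []) (s≤s y≤v) = ≤-trans y≤v v≤x ∷ t
Sorted-++ (x ∷ x' ∷ xs) ys (x≥x' ∷ s) t (_ ∷ a) h = x≥x' ∷ Sorted-++ (x' ∷ xs) ys s t a h

Sorted-replicate : ∀ n v → Sorted (replicate n v)
Sorted-replicate zero v = []
Sorted-replicate (suc zero) v = [-]
Sorted-replicate (suc (suc n)) v = ≤-refl ∷ Sorted-replicate (suc n) v

Sorted-++⁻ˡ : ∀ xs {ys} → Sorted (xs ++ ys) → Sorted xs
Sorted-++⁻ˡ [] _ = []
Sorted-++⁻ˡ (x ∷ []) _ = [-]
Sorted-++⁻ˡ (x ∷ x' ∷ xs) (x≥x' ∷ s) = x≥x' ∷ Sorted-++⁻ˡ (x' ∷ xs) s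

Sorted-++⁻ʳ : ∀ xs {ys} → Sorted (xs ++ ys) → Sorted ys
Sorted-++⁻ʳ [] s = s
Sorted-++⁻ʳ (x ∷ xs) s = Sorted-++⁻ʳ xs (Sorted-tail s)

Sorted-∷ʳ⇒All≥ : ∀ xs v → Sorted (xs ++ [ v ]) → All (v ≤_) xs
Sorted-∷ʳ⇒All≥ [] v _ = []
Sorted-∷ʳ⇒All≥ (x ∷ []) v (x≥v ∷ _) = x≥v ∷ []
Sorted-∷ʳ⇒All≥ (x ∷ x' ∷ xs) v (x≥x' ∷ s) with Sorted-∷ʳ⇒All≥ (x' ∷ xs) v s
... | x'≥v ∷ a = ≤-trans x'≥v x≥x' ∷ x'≥v ∷ a

HeadBelow-run : ∀ {v} b X → HeadBelow v X → HeadBelow (suc v) (replicate b v ++ X)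
HeadBelow-run zero X h = HeadBelow-mono X (n≤1+n _) h
HeadBelow-run (suc b) X _ = ≤-refl

HeadBelow-replicate : ∀ {v w} b → v < w → HeadBelow w (replicate b v)
HeadBelow-replicate zero _ = tt
HeadBelow-replicate (suc b) v<w = v<w

++-≢[] : ∀ {A : Set} (xs : List A) {ys} → ys ≢ [] → xs ++ ys ≢ []
++-≢[] [] ys≢[] = ys≢[]
++-≢[] (_ ∷ _) _ ()

run-≢[] : ∀ b {v : ℕ} X → 1 ≤ b → replicate b v ++ X ≢ []
run-≢[] (suc b) X _ ()

replicate-split : ∀ {n b} (v : ℕ) → n ≤ b → replicate b v ≡ replicate n v ++ replicate (b ∸ n) v
replicate-split {zero} v _ = refl
replicate-split {suc n} {suc b} v (s≤s n≤b) = cong (v ∷_) (replicate-split v n≤b)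

splitRun : ∀ v xs → Sorted xs → HeadBelow (suc v) xs →
  Σ ℕ λ a → Σ (List ℕ) λ z → (xs ≡ replicate a v ++ z) × HeadBelow v z × Sorted z
splitRun v [] _ _ = 0 , [] , refl , tt , []
splitRun v (x ∷ xs) s (s≤s x≤v) with m≤n⇒m<n∨m≡n x≤v
... | inj₁ x<v = 0 , x ∷ xs , refl , x<v , s
... | inj₂ refl with splitRun v xs (Sorted-tail s) (HeadBelow-tail s)
...   | a , z , refl , h , t = suc a , z , refl , h , t

ltL-longerRun : ∀ {b b' v} X Y → b < b' → HeadBelow v X →
                ltL (replicate b v ++ X) (replicate b' v ++ Y)
ltL-longerRun {zero} {suc _} [] Y _ _ = tt
ltL-longerRun {zero} {suc _} (x ∷ X) Y _ x<v = inj₁ x<v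
ltL-longerRun {suc b} {suc b'} X Y (s≤s b<b') h = inj₂ (refl , ltL-longerRun X Y b<b' h)

ltL-run⁻ : ∀ a a' {v} z z' → HeadBelow v z → HeadBelow v z' →
           ltL (replicate a v ++ z) (replicate a' v ++ z') → a < a' ⊎ (a ≡ a' × ltL z z')
ltL-run⁻ zero zero z z' _ _ p = inj₂ (refl , p)
ltL-run⁻ zero (suc a') z z' _ _ _ = inj₁ (s≤s z≤n)
ltL-run⁻ (suc a) zero z (y ∷ z') _ y<v (inj₁ v<y) = ⊥-elim (<-asym v<y y<v)
ltL-run⁻ (suc a) zero z (y ∷ z') _ y<v (inj₂ (refl , _)) = ⊥-elim (<-irrefl refl y<v)
ltL-run⁻ (suc a) (suc a') z z' _ _ (inj₁ v<v) = ⊥-elim (<-irrefl refl v<v)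
ltL-run⁻ (suc a) (suc a') z z' h h' (inj₂ (_ , p)) with ltL-run⁻ a a' z z' h h' p
... | inj₁ a<a' = inj₁ (s≤s a<a')
... | inj₂ (refl , q) = inj₂ (refl , q)

count : ℕ → List ℕ → ℕ
count γ xs = length (filter (_≟ γ) xs)

count-++ : ∀ γ xs ys → count γ (xs ++ ys) ≡ count γ xs + count γ ys
count-++ γ xs ys = trans (cong length (filter-++ (_≟ γ) xs ys)) (length-++ (filter (_≟ γ) xs))

count-here : ∀ γ xs → count γ (γ ∷ xs) ≡ suc (count γ xs)
count-here γ xs = cong length (filter-accept (_≟ γ) {x = γ} {xs = xs} refl)

count-there : ∀ γ {x} xs → x ≢ γ → count γ (x ∷ xs) ≡ count γ xs
count-there γ xs x≢γ = cong length (filter-reject (_≟ γ) {xs = xs} x≢γ)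

count-none : ∀ γ {xs} → All (_≢ γ) xs → count γ xs ≡ 0
count-none γ a = cong length (filter-none (_≟ γ) a)

count-below : ∀ γ {xs} → All (_< γ) xs → count γ xs ≡ 0
count-below γ a = count-none γ (All.map (λ x<γ x≡γ → <-irrefl x≡γ x<γ) a)

count-above : ∀ γ {xs} → All (γ <_) xs → count γ xs ≡ 0
count-above γ a = count-none γ (All.map (λ γ<x x≡γ → <-irrefl (sym x≡γ) γ<x) a)

count-replicate : ∀ γ n → count γ (replicate n γ) ≡ n
count-replicate γ zero = refl
count-replicate γ (suc n) = trans (count-here γ (replicate n γ)) (cong suc (count-replicate γ n))

count-run : ∀ v a z → All (_< v) z → count v (replicate a v ++ z) ≡ a
count-run v a z z<v = begin
  count v (replicate a v ++ z)                ≡⟨ count-++ v (replicate a v) z ⟩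
  count v (replicate a v) + count v z         ≡⟨ cong₂ _+_ (count-replicate v a) (count-below v z<v) ⟩
  a + 0                                       ≡⟨ +-identityʳ a ⟩
  a                                           ∎
  where open ≡-Reasoning

count-skipRun : ∀ γ {v} a z → γ < v → count γ (replicate a v ++ z) ≡ count γ z
count-skipRun γ a z γ<v = trans (count-++ γ (replicate a _) z)
  (cong (_+ count γ z) (count-above γ (replicate⁺ a γ<v)))

[]⊎∷ʳ : ∀ xs → xs ≡ [] ⊎ Σ (List ℕ) λ y → Σ ℕ λ t → xs ≡ y ++ [ t ]
[]⊎∷ʳ xs with initLast xs
... | [] = inj₁ refl
... | y ∷ʳ′ t = inj₂ (y , t , refl)

lastL-++ : ∀ xs y ys → lastL (xs ++ y ∷ ys) ≡ lastL (y ∷ ys)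
lastL-++ [] y ys = refl
lastL-++ (x ∷ []) y ys = refl
lastL-++ (x ∷ x' ∷ xs) y ys = lastL-++ (x' ∷ xs) y ys

lastL-++-≢[] : ∀ xs ys → ys ≢ [] → lastL (xs ++ ys) ≡ lastL ys
lastL-++-≢[] xs [] ys≢[] = ⊥-elim (ys≢[] refl)
lastL-++-≢[] xs (y ∷ ys) _ = lastL-++ xs y ys

lastL-replicate : ∀ a v → lastL (replicate (suc a) v) ≡ v
lastL-replicate zero v = refl
lastL-replicate (suc a) v = lastL-replicate a v

lastL-< : ∀ {v} xs → 1 ≤ v → Sorted xs → HeadBelow v xs → lastL xs < v
lastL-< [] 1≤v _ _ = 1≤v
lastL-< (x ∷ []) _ _ x<v = x<v
lastL-< (x ∷ y ∷ xs) 1≤v (x≥y ∷ s) x<v = lastL-< (y ∷ xs) 1≤v s (≤-<-trans x≥y x<v)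

lastL-≥ : ∀ {v} x xs → All (v ≤_) (x ∷ xs) → v ≤ lastL (x ∷ xs)
lastL-≥ x [] (v≤x ∷ []) = v≤x
lastL-≥ x (y ∷ xs) (_ ∷ a) = lastL-≥ y xs a

takeWhile-≥-++ : ∀ K Q μ → All (K ≤_) Q → HeadBelow K μ → takeWhile (K ≤?_) (Q ++ μ) ≡ Q
takeWhile-≥-++ K [] [] _ _ = refl
takeWhile-≥-++ K [] (y ∷ μ) _ y<K rewrite dec-false (K ≤? y) (<⇒≱ y<K) = refl
takeWhile-≥-++ K (q ∷ Q) μ (K≤q ∷ a) h rewrite dec-true (K ≤? q) K≤q =
  cong (q ∷_) (takeWhile-≥-++ K Q μ a h)

HeadBelow-dropWhile : ∀ K xs → HeadBelow K (dropWhile (K ≤?_) xs)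
HeadBelow-dropWhile K xs with dropWhile (K ≤?_) xs | all-head-dropWhile (K ≤?_) xs
... | [] | _ = tt
... | y ∷ _ | Maybe.just K≰y = ≰⇒> K≰y

-- The collapse of T(θ) onto ω^K+1

-- For nonempty Q the tails μ of the elements Q+μ ⊏ θ are exactly 1 ≤ μ < ω^K, and
-- μ ↦ −1+μ (drop one exponent 0) maps these onto ω^K.
Admissible : List ℕ → List ℕ → Set
Admissible [] μ = ⊤
Admissible (_ ∷ _) [] = ⊥
Admissible (_ ∷ _) (_ ∷ _) = ⊤

≢[]⇒Admissible : ∀ Q μ → μ ≢ [] → Admissible Q μ
≢[]⇒Admissible [] μ _ = tt
≢[]⇒Admissible (_ ∷ _) [] μ≢[] = μ≢[] refl
≢[]⇒Admissible (_ ∷ _) (_ ∷ _) _ = tt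

shift : List ℕ → List ℕ → List ℕ
shift [] μ = μ
shift (_ ∷ _) (zero ∷ μ) = μ
shift (_ ∷ _) μ = μ

unshift : List ℕ → List ℕ → List ℕ
unshift [] δ = δ
unshift (_ ∷ _) [] = 0 ∷ []
unshift (_ ∷ _) (zero ∷ δ) = 0 ∷ 0 ∷ δ
unshift (_ ∷ _) (suc x ∷ δ) = suc x ∷ δ

shift-unshift : ∀ Q δ → shift Q (unshift Q δ) ≡ δ
shift-unshift [] δ = refl
shift-unshift (_ ∷ _) [] = refl
shift-unshift (_ ∷ _) (zero ∷ δ) = refl
shift-unshift (_ ∷ _) (suc x ∷ δ) = refl

unshift-admissible : ∀ Q δ → Admissible Q (unshift Q δ)
unshift-admissible [] δ = tt
unshift-admissible (_ ∷ _) [] = tt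
unshift-admissible (_ ∷ _) (zero ∷ δ) = tt
unshift-admissible (_ ∷ _) (suc x ∷ δ) = tt

unshift-headBelow : ∀ {K} Q δ → 1 ≤ K → HeadBelow K δ → HeadBelow K (unshift Q δ)
unshift-headBelow [] δ _ h = h
unshift-headBelow (_ ∷ _) [] 1≤K _ = 1≤K
unshift-headBelow (_ ∷ _) (zero ∷ δ) 1≤K _ = 1≤K
unshift-headBelow (_ ∷ _) (suc x ∷ δ) _ h = h

unshift-sorted : ∀ Q δ → Sorted δ → Sorted (unshift Q δ)
unshift-sorted [] δ s = s
unshift-sorted (_ ∷ _) [] _ = [-]
unshift-sorted (_ ∷ _) (zero ∷ δ) s = z≤n ∷ s
unshift-sorted (_ ∷ _) (suc x ∷ δ) s = s

shift-sorted : ∀ Q μ → Sorted μ → Sorted (shift Q μ)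
shift-sorted [] μ s = s
shift-sorted (_ ∷ _) [] s = s
shift-sorted (_ ∷ _) (zero ∷ μ) s = Sorted-tail s
shift-sorted (_ ∷ _) (suc x ∷ μ) s = s

shift-headBelow : ∀ {K} Q μ → Sorted μ → HeadBelow K μ → HeadBelow K (shift Q μ)
shift-headBelow [] μ _ h = h
shift-headBelow (_ ∷ _) [] _ h = h
shift-headBelow (_ ∷ _) (zero ∷ []) _ _ = tt
shift-headBelow (_ ∷ _) (zero ∷ y ∷ μ) (0≥y ∷ _) 0<K = ≤-<-trans 0≥y 0<K
shift-headBelow (_ ∷ _) (suc x ∷ μ) _ h = h

shift-mono : ∀ Q μ μ' → Admissible Q μ → Sorted μ → ltL μ μ' → ltL (shift Q μ) (shift Q μ')
shift-mono [] μ μ' _ _ p = p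
shift-mono (_ ∷ _) (zero ∷ μ) (zero ∷ μ') _ _ (inj₂ (_ , p)) = p
shift-mono (_ ∷ _) (zero ∷ []) (suc y ∷ μ') _ _ _ = tt
shift-mono (_ ∷ _) (zero ∷ x ∷ μ) (suc y ∷ μ') _ (0≥x ∷ _) _ = inj₁ (s≤s (≤-trans 0≥x z≤n))
shift-mono (_ ∷ _) (suc x ∷ μ) (zero ∷ μ') _ _ (inj₂ (() , _))
shift-mono (_ ∷ _) (suc x ∷ μ) (suc y ∷ μ') _ _ p = p

drop-length-++ : ∀ (Q μ : List ℕ) → drop (length Q) (Q ++ μ) ≡ μ
drop-length-++ [] μ = refl
drop-length-++ (q ∷ Q) μ = drop-length-++ Q μ

Sorted-drop : ∀ n xs → Sorted xs → Sorted (drop n xs)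
Sorted-drop zero xs s = s
Sorted-drop (suc n) [] s = s
Sorted-drop (suc n) (x ∷ xs) s = Sorted-drop n xs (Sorted-tail s)

module Collapse (θ : Ord) (Q : List ℕ) (K : ℕ) (θ≡ : exps θ ≡ Q ++ [ K ]) (1≤K : 1 ≤ K) where

  Q≥K : All (K ≤_) Q
  Q≥K = Sorted-∷ʳ⇒All≥ Q K (subst Sorted θ≡ (sorted θ))

  Sorted-Q++ : ∀ μ → Sorted μ → HeadBelow (suc K) μ → Sorted (Q ++ μ)
  Sorted-Q++ μ s h = Sorted-++ Q μ (Sorted-++⁻ˡ Q (subst Sorted θ≡ (sorted θ))) s Q≥K h

  ⊏θ⇒tail : ∀ β → β ⊏ θ → Σ (List ℕ) λ μ → (exps β ≡ Q ++ μ) × HeadBelow K μ × Admissible Q μ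
  ⊏θ⇒tail β (γ , _ , CBβ<γ , θ≡β+ω^γ)
    with ∷ʳ-injective Q (takeWhile (γ ≤?_) (exps β)) (trans (sym θ≡) θ≡β+ω^γ)
  ... | Q≡ , refl = μ , β≡ , HeadBelow-dropWhile K (exps β) , admissible Q μ β≡ Q≥K
    where
    μ : List ℕ
    μ = dropWhile (K ≤?_) (exps β)
    β≡ : exps β ≡ Q ++ μ
    β≡ = trans (sym (takeWhile++dropWhile (K ≤?_) (exps β))) (cong (_++ μ) (sym Q≡))
    admissible : ∀ Q' μ' → exps β ≡ Q' ++ μ' → All (K ≤_) Q' → Admissible Q' μ'
    admissible [] _ _ _ = tt
    admissible (_ ∷ _) (_ ∷ _) _ _ = tt
    admissible (q ∷ Q') [] e a = <⇒≱ CBβ<γ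
      (subst (λ xs → K ≤ lastL xs) (sym (trans e (++-identityʳ (q ∷ Q')))) (lastL-≥ q Q' a))

  lastL-Q++ : ∀ μ → Sorted (Q ++ μ) → HeadBelow K μ → Admissible Q μ → lastL (Q ++ μ) < K
  lastL-Q++ [] _ _ adm = lastL-empty Q adm
    where
    lastL-empty : ∀ Q' → Admissible Q' [] → lastL (Q' ++ []) < K
    lastL-empty [] _ = 1≤K
  lastL-Q++ (y ∷ μ) s h _ =
    subst (_< K) (sym (lastL-++ Q y μ)) (lastL-< (y ∷ μ) 1≤K (Sorted-++⁻ʳ Q s) h)

  tail⇒⊏θ : ∀ μ (s : Sorted (Q ++ μ)) → HeadBelow K μ → Admissible Q μ → mkOrd (Q ++ μ) s ⊏ θ
  tail⇒⊏θ μ s h adm = K , 1≤K , lastL-Q++ μ s h adm ,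
    trans θ≡ (cong (_++ [ K ]) (sym (takeWhile-≥-++ K Q μ Q≥K h)))

  collapse : Ord → Ord
  collapse β with List.≡-dec _≟_ (exps β) (exps θ)
  ... | yes _ = ωpow K
  ... | no _ = mkOrd (shift Q (drop (length Q) (exps β)))
                     (shift-sorted Q _ (Sorted-drop (length Q) (exps β) (sorted β)))

  collapse-top : collapse θ ≡ ωpow K
  collapse-top with List.≡-dec _≟_ (exps θ) (exps θ)
  ... | yes _ = refl
  ... | no θ≢θ = ⊥-elim (θ≢θ refl)

  Q++<θ : ∀ μ → HeadBelow K μ → ltL (Q ++ μ) (exps θ)
  Q++<θ μ h = subst (ltL (Q ++ μ)) (sym θ≡) (ltL-++⁺ Q (HeadBelow⇒ltL μ h))

  collapse-tail : ∀ β μ → exps β ≡ Q ++ μ → HeadBelow K μ → exps (collapse β) ≡ shift Q μ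
  collapse-tail β μ β≡ h with List.≡-dec _≟_ (exps β) (exps θ)
  ... | yes e = ⊥-elim (ltL-irrefl (exps θ) (subst (λ xs → ltL xs (exps θ)) (trans (sym β≡) e) (Q++<θ μ h)))
  ... | no _ = cong (shift Q) (trans (cong (drop (length Q)) β≡) (drop-length-++ Q μ))

  private
    Sorted-tail-of : ∀ β μ → exps β ≡ Q ++ μ → Sorted μ
    Sorted-tail-of β μ β≡ = Sorted-++⁻ʳ Q (subst Sorted β≡ (sorted β))

  collapse-⊏ : ∀ β → β ⊏ θ → collapse β <ₒ ωpow K
  collapse-⊏ β β⊏θ with ⊏θ⇒tail β β⊏θ
  ... | μ , β≡ , h , _ = subst (λ xs → ltL xs [ K ]) (sym (collapse-tail β μ β≡ h))
      (HeadBelow⇒ltL (shift Q μ) (shift-headBelow Q μ (Sorted-tail-of β μ β≡) h))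

  collapse-mono : ∀ β β' → T θ β → T θ β' → β <ₒ β' → collapse β <ₒ collapse β'
  collapse-mono β β' (inj₁ refl) (inj₁ refl) β<β' = ⊥-elim (ltL-irrefl (exps θ) β<β')
  collapse-mono β β' (inj₁ refl) (inj₂ β'⊏θ) θ<β' with ⊏θ⇒tail β' β'⊏θ
  ... | μ , β'≡ , h , _ =
    ⊥-elim (ltL-asym (exps θ) (exps β') θ<β' (subst (λ xs → ltL xs (exps θ)) (sym β'≡) (Q++<θ μ h)))
  collapse-mono β β' (inj₂ β⊏θ) (inj₁ refl) _ =
    subst (λ γ → collapse β <ₒ γ) (sym collapse-top) (collapse-⊏ β β⊏θ)
  collapse-mono β β' (inj₂ β⊏θ) (inj₂ β'⊏θ) β<β' with ⊏θ⇒tail β β⊏θ | ⊏θ⇒tail β' β'⊏θ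
  ... | μ , β≡ , h , adm | μ' , β'≡ , h' , _ =
    subst₂ ltL (sym (collapse-tail β μ β≡ h)) (sym (collapse-tail β' μ' β'≡ h'))
      (shift-mono Q μ μ' adm (Sorted-tail-of β μ β≡) (ltL-++⁻ Q (subst₂ ltL β≡ β'≡ β<β')))

  collapse-onto : ∀ δ → δ ≤ₒ ωpow K → Σ Ord λ β → T θ β × (collapse β ≡ δ)
  collapse-onto δ (inj₂ refl) = θ , inj₁ refl , collapse-top
  collapse-onto δ (inj₁ δ<ω^K) =
    β , inj₂ (tail⇒⊏θ μ (sorted β) hμ (unshift-admissible Q (exps δ))) ,
    exps-injective (trans (collapse-tail β μ refl hμ) (shift-unshift Q (exps δ)))
    where
    μ : List ℕ
    μ = unshift Q (exps δ)
    hμ : HeadBelow K μ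
    hμ = unshift-headBelow Q (exps δ) 1≤K (ltL⇒HeadBelow (exps δ) δ<ω^K)
    β : Ord
    β = mkOrd (Q ++ μ) (Sorted-Q++ μ (unshift-sorted Q (exps δ) (sorted δ)) (HeadBelow-mono μ (n≤1+n K) hμ))

  collapse-iso : OrdIso (T θ) (λ δ → δ ≤ₒ ωpow K) collapse
  collapse-iso = into , collapse-mono , collapse-onto
    where
    into : ∀ β → T θ β → collapse β ≤ₒ ωpow K
    into β (inj₁ refl) = inj₂ collapse-top
    into β (inj₂ β⊏θ) = inj₁ (collapse-⊏ β β⊏θ)

OrdIso-self⇒id : ∀ (D : Ord → Set) f → OrdIso D D f → ∀ x → D x → f x ≡ x
OrdIso-self⇒id D f (into , mono , onto) x Dx = go x (<ₒ-wellFounded x) Dx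
  where
  go : ∀ x → Acc _<ₒ_ x → D x → f x ≡ x
  go x (acc rs) Dx with <ₒ-trichotomy (f x) x
  ... | inj₂ (inj₁ fx≡x) = fx≡x
  ... | inj₁ fx<x = ⊥-elim (ltL-irrefl (exps (f x))
        (subst (λ y → ltL (exps y) (exps (f x))) (go (f x) (rs fx<x) (into x Dx))
          (mono (f x) x (into x Dx) Dx fx<x)))
  ... | inj₂ (inj₂ x<fx) with onto x Dx
  ...   | y , Dy , fy≡x with <ₒ-trichotomy y x
  ...     | inj₁ y<x = ⊥-elim (ltL-irrefl (exps y)
            (subst (λ z → ltL (exps y) (exps z)) (trans (sym fy≡x) (go y (rs y<x) Dy)) y<x))
  ...     | inj₂ (inj₁ refl) = fy≡x
  ...     | inj₂ (inj₂ x<y) = ⊥-elim (ltL-asym (exps x) (exps (f x)) x<fx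
            (subst (λ z → ltL (exps (f x)) (exps z)) fy≡x (mono x y Dx Dy x<y)))

module _ (k : ℕ) (1≤k : 1 ≤ k) where
  open Collapse (ωpow k) [] k refl 1≤k

  <ω^⇒⊏ : ∀ x → x <ₒ ωpow k → x ⊏ ωpow k
  <ω^⇒⊏ x x<ω^k = tail⇒⊏θ (exps x) (sorted x) (ltL⇒HeadBelow (exps x) x<ω^k) tt

  ⊏ω^⇒< : ∀ x → x ⊏ ωpow k → x <ₒ ωpow k
  ⊏ω^⇒< x x⊏ω^k with ⊏θ⇒tail x x⊏ω^k
  ... | μ , x≡ , h , _ = subst (λ xs → ltL xs [ k ]) (sym x≡) (HeadBelow⇒ltL μ h)

  T-ω^⇒≤ : ∀ x → T (ωpow k) x → x ≤ₒ ωpow k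
  T-ω^⇒≤ x (inj₁ refl) = inj₂ refl
  T-ω^⇒≤ x (inj₂ x⊏ω^k) = inj₁ (⊏ω^⇒< x x⊏ω^k)

  ≤ω^⇒T : ∀ x → x ≤ₒ ωpow k → T (ωpow k) x
  ≤ω^⇒T x (inj₂ refl) = inj₁ refl
  ≤ω^⇒T x (inj₁ x<ω^k) = inj₂ (<ω^⇒⊏ x x<ω^k)

  -- T(ω^k) is {δ : δ ≤ ω^k} itself, so its collapse in F(ω^k) is the identity.
  OrdIso-T-ω^⇒id : ∀ f → OrdIso (T (ωpow k)) (λ δ → δ ≤ₒ ωpow k) f → ∀ x → T (ωpow k) x → f x ≡ x
  OrdIso-T-ω^⇒id f (into , mono , onto) x Tx =
    OrdIso-self⇒id (λ δ → δ ≤ₒ ωpow k) f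
      ( (λ y y≤ → into y (≤ω^⇒T y y≤))
      , (λ y z y≤ z≤ → mono y z (≤ω^⇒T y y≤) (≤ω^⇒T z z≤))
      , (λ y y≤ → let (z , Tz , fz≡y) = onto y y≤ in z , T-ω^⇒≤ z Tz , fz≡y))
      x (T-ω^⇒≤ x Tx)

pL : List ℕ → ℕ
pL xs = if finL xs then suc (length xs) else count (lastL xs) xs

lastL-zeros : ∀ {ys} → Sorted (0 ∷ ys) → lastL (0 ∷ ys) ≡ 0
lastL-zeros [-] = refl
lastL-zeros (z≤n ∷ s) = lastL-zeros s

count-zeros : ∀ {ys} → Sorted (0 ∷ ys) → count 0 (0 ∷ ys) ≡ suc (length ys)
count-zeros [-] = refl
count-zeros (z≤n ∷ s) = cong suc (count-zeros s)

finL-zeros : ∀ {ys} → Sorted (0 ∷ ys) → finL ys ≡ true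
finL-zeros [-] = refl
finL-zeros (z≤n ∷ _) = refl

r<pL⇒r≤count : ∀ xs r → Sorted xs → r < pL xs → r ≤ count (lastL xs) xs
r<pL⇒r≤count [] r _ (s≤s z≤n) = z≤n
r<pL⇒r≤count (suc x ∷ xs) r _ r<p = <⇒≤ r<p
r<pL⇒r≤count (zero ∷ ys) r s (s≤s r≤) rewrite lastL-zeros s | count-zeros s = r≤

count≤pL-shift : ∀ Q μ → Sorted μ → μ ≢ [] → count (lastL μ) μ ≤ pL (shift Q μ)
count≤pL-shift Q [] _ μ≢[] = ⊥-elim (μ≢[] refl)
count≤pL-shift [] (suc x ∷ μ) _ _ = ≤-refl
count≤pL-shift (_ ∷ _) (suc x ∷ μ) _ _ = ≤-refl
count≤pL-shift [] (zero ∷ ys) s _ rewrite lastL-zeros s | count-zeros s = n≤1+n _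
count≤pL-shift (_ ∷ _) (zero ∷ ys) s _ rewrite lastL-zeros s | count-zeros s | finL-zeros s = ≤-refl

lastL-shift : ∀ Q μ → Sorted μ → lastL (shift Q μ) ≡ lastL μ
lastL-shift [] μ _ = refl
lastL-shift (_ ∷ _) [] _ = refl
lastL-shift (_ ∷ _) (zero ∷ []) _ = refl
lastL-shift (_ ∷ _) (zero ∷ y ∷ ys) (z≤n ∷ s) = refl
lastL-shift (_ ∷ _) (suc x ∷ μ) _ = refl

count-shift : ∀ Q μ γ → 1 ≤ γ → count γ (shift Q μ) ≡ count γ μ
count-shift [] μ γ _ = refl
count-shift (_ ∷ _) [] γ _ = refl
count-shift (_ ∷ _) (zero ∷ μ) γ 1≤γ = sym (count-there γ μ (λ 0≡γ → <-irrefl 0≡γ 1≤γ))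
count-shift (_ ∷ _) (suc x ∷ μ) γ _ = refl

count-takeWhile : ∀ γ xs → Sorted xs → count γ (takeWhile (γ ≤?_) xs) ≡ count γ xs
count-takeWhile γ xs s = begin
  count γ tw                     ≡⟨ sym (+-identityʳ _) ⟩
  count γ tw + 0                 ≡⟨ cong (count γ tw +_) (sym (count-below γ dw<γ)) ⟩
  count γ tw + count γ dw        ≡⟨ sym (count-++ γ tw dw) ⟩
  count γ (tw ++ dw)             ≡⟨ cong (count γ) (takeWhile++dropWhile (γ ≤?_) xs) ⟩
  count γ xs                     ∎
  where
  open ≡-Reasoning
  tw : List ℕ
  tw = takeWhile (γ ≤?_) xs
  dw : List ℕ
  dw = dropWhile (γ ≤?_) xs
  dw<γ : All (_< γ) dw
  dw<γ = Sorted⇒All< (Sorted-++⁻ʳ tw (subst Sorted (sym (takeWhile++dropWhile (γ ≤?_) xs)) s))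
                     (HeadBelow-dropWhile γ xs)

pL-∷ʳ : ∀ tw γ → 1 ≤ γ → All (γ ≤_) tw → pL (tw ++ [ γ ]) ≡ suc (count γ tw)
pL-∷ʳ [] (suc g) _ _ = count-here (suc g) []
pL-∷ʳ (zero ∷ tw) γ 1≤γ (γ≤0 ∷ _) = ⊥-elim (<-irrefl refl (≤-trans 1≤γ γ≤0))
pL-∷ʳ (suc x ∷ tw) γ _ _ = begin
  count (lastL (suc x ∷ tw ++ [ γ ])) (suc x ∷ tw ++ [ γ ]) ≡⟨ cong (λ v → count v (suc x ∷ tw ++ [ γ ])) (lastL-++ (suc x ∷ tw) γ []) ⟩
  count γ ((suc x ∷ tw) ++ [ γ ])                             ≡⟨ count-++ γ (suc x ∷ tw) [ γ ] ⟩
  count γ (suc x ∷ tw) + count γ [ γ ]                        ≡⟨ cong (count γ (suc x ∷ tw) +_) (count-here γ []) ⟩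
  count γ (suc x ∷ tw) + 1                                    ≡⟨ +-comm _ 1 ⟩
  suc (count γ (suc x ∷ tw))                                  ∎
  where open ≡-Reasoning

pL-addωL : ∀ xs γ → 1 ≤ γ → Sorted xs → pL (addωL xs γ) ≡ suc (count γ xs)
pL-addωL xs γ 1≤γ s = trans (pL-∷ʳ (takeWhile (γ ≤?_) xs) γ 1≤γ (all-takeWhile (γ ≤?_) xs))
                             (cong suc (count-takeWhile γ xs s))

Sorted-addωL : ∀ xs γ → Sorted xs → Sorted (addωL xs γ)
Sorted-addωL xs γ s = Sorted-++ (takeWhile (γ ≤?_) xs) [ γ ]
  (Sorted-++⁻ˡ (takeWhile (γ ≤?_) xs) (subst Sorted (sym (takeWhile++dropWhile (γ ≤?_) xs)) s))
  [-] (all-takeWhile (γ ≤?_) xs) ≤-refl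

_+ω^_ : Ord → ℕ → Ord
δ +ω^ γ = mkOrd (addωL (exps δ) γ) (Sorted-addωL (exps δ) γ (sorted δ))

⊏-+ω^ : ∀ δ γ → 1 ≤ γ → CB δ < γ → δ ⊏ δ +ω^ γ
⊏-+ω^ δ γ 1≤γ CBδ<γ = γ , 1≤γ , CBδ<γ , refl

-- For the exponent i itself this is r < p δ, above it r < p of the ancestor δ + ω^j.
Fω-digits : ∀ k i r δ → i < k → Fω k r i δ →
  δ <ₒ ωpow k × CB δ ≡ i × (∀ j → i ≤ j → j < k → r ≤ count j (exps δ))
Fω-digits k i r δ i<k (inj₂ (refl , _)) = ⊥-elim (<-irrefl refl i<k)
Fω-digits k i r δ i<k (inj₁ (_ , (δ⊏ω^k , CBδ≡i) , r<pδ , ancestors)) = δ<ω^k , CBδ≡i , frequent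
  where
  1≤k : 1 ≤ k
  1≤k = ≤-trans (s≤s z≤n) i<k
  δ<ω^k : δ <ₒ ωpow k
  δ<ω^k = ⊏ω^⇒< k 1≤k δ δ⊏ω^k
  ds : List ℕ
  ds = exps δ
  frequent : ∀ j → i ≤ j → j < k → r ≤ count j ds
  frequent j i≤j j<k with m≤n⇒m<n∨m≡n i≤j
  ... | inj₂ refl = subst (λ v → r ≤ count v ds) CBδ≡i (r<pL⇒r≤count ds r (sorted δ) r<pδ)
  ... | inj₁ i<j = ≤-pred (subst (r <_) (pL-addωL ds j 1≤j (sorted δ)) (ancestors (δ +ω^ j) δ⊏ ancestor<))
    where
    1≤j : 1 ≤ j
    1≤j = ≤-trans (s≤s z≤n) i<j
    δ⊏ : δ ⊏ δ +ω^ j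
    δ⊏ = ⊏-+ω^ δ j 1≤j (subst (_< j) (sym CBδ≡i) i<j)
    ancestor< : δ +ω^ j ⊏ ωpow k
    ancestor< = <ω^⇒⊏ k 1≤k (δ +ω^ j) (HeadBelow⇒ltL (addωL ds j)
      (All<⇒HeadBelow (++⁺ (takeWhile⁺ (j ≤?_) (Sorted⇒All< (sorted δ) (ltL⇒HeadBelow ds δ<ω^k))) (j<k ∷ []))))

-- The coding of ω^k by multiplicities of exponents

fill : ℕ → ℕ → ℕ → List ℕ
fill n lo zero = []
fill n lo (suc d) = replicate n (lo + suc d) ++ fill n lo d

fill-bounds : ∀ n lo d → All (λ y → lo < y × y ≤ lo + d) (fill n lo d)
fill-bounds n lo zero = []
fill-bounds n lo (suc d) = ++⁺ (replicate⁺ n (lo<lo+suc-d , ≤-refl))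
  (All.map (λ (lo<y , y≤) → lo<y , ≤-trans y≤ (+-monoʳ-≤ lo (n≤1+n d))) (fill-bounds n lo d))
  where
  lo<lo+suc-d : lo < lo + suc d
  lo<lo+suc-d = subst (lo <_) (sym (+-suc lo d)) (s≤s (m≤m+n lo d))

HeadBelow-fill : ∀ n lo d → HeadBelow (suc (lo + d)) (fill n lo d)
HeadBelow-fill n lo d = All<⇒HeadBelow (All.map (λ (_ , y≤) → s≤s y≤) (fill-bounds n lo d))

Sorted-fill : ∀ n lo d → Sorted (fill n lo d)
Sorted-fill n lo zero = []
Sorted-fill n lo (suc d) = Sorted-++ (replicate n (lo + suc d)) (fill n lo d)
  (Sorted-replicate n _) (Sorted-fill n lo d) (replicate⁺ n ≤-refl)
  (HeadBelow-mono (fill n lo d) (s≤s (+-monoʳ-≤ lo (n≤1+n d))) (HeadBelow-fill n lo d))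

count-fill : ∀ γ n lo d → lo < γ → γ ≤ lo + d → count γ (fill n lo d) ≡ n
count-fill γ n lo zero lo<γ γ≤lo = ⊥-elim (<-irrefl refl (<-≤-trans lo<γ (≤-trans γ≤lo (≤-reflexive (+-identityʳ lo)))))
count-fill γ n lo (suc d) lo<γ γ≤ with m≤n⇒m<n∨m≡n γ≤
... | inj₂ refl = count-run (lo + suc d) n (fill n lo d)
      (All.map (λ {y} (_ , y≤) → subst (y <_) (sym (+-suc lo d)) (s≤s y≤)) (fill-bounds n lo d))
... | inj₁ γ< = trans (count-skipRun γ n (fill n lo d) γ<)
      (count-fill γ n lo d lo<γ (≤-pred (subst (γ <_) (+-suc lo d) γ<)))

ltL-fill : ∀ {n n'} lo d U V → n ≤ n' → HeadBelow (suc lo) U → ltL U V →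
           ltL (fill n lo d ++ U) (fill n' lo d ++ V)
ltL-fill lo zero U V _ _ U<V = U<V
ltL-fill {n} {n'} lo (suc d) U V n≤n' hU U<V
  rewrite ++-assoc (replicate n (lo + suc d)) (fill n lo d) U
        | ++-assoc (replicate n' (lo + suc d)) (fill n' lo d) V
  with m≤n⇒m<n∨m≡n n≤n'
... | inj₁ n<n' = ltL-longerRun (fill n lo d ++ U) _ n<n'
      (HeadBelow-++ (fill n lo d) U
        (HeadBelow-mono (fill n lo d) (≤-reflexive (sym (+-suc lo d))) (HeadBelow-fill n lo d))
        (HeadBelow-mono U (≤-trans (s≤s (m≤m+n lo d)) (≤-reflexive (sym (+-suc lo d)))) hU))
... | inj₂ refl = ltL-++⁺ (replicate n (lo + suc d)) (ltL-fill lo d U V ≤-refl hU U<V)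

fill-prefix : ∀ n n' b lo d → n ≤ n' → n ≤ b →
              Σ (List ℕ) λ W → fill n' lo d ++ replicate b lo ≡ replicate n (lo + d) ++ W
fill-prefix n n' b lo zero _ n≤b =
  replicate (b ∸ n) lo , trans (replicate-split lo n≤b) (cong (λ v → replicate n v ++ replicate (b ∸ n) lo) (sym (+-identityʳ lo)))
fill-prefix n n' b lo (suc d) n≤n' _ = replicate (n' ∸ n) (lo + suc d) ++ fill n' lo d ++ replicate b lo , (begin
  (replicate n' v ++ fill n' lo d) ++ replicate b lo         ≡⟨ ++-assoc (replicate n' v) _ _ ⟩
  replicate n' v ++ fill n' lo d ++ replicate b lo           ≡⟨ cong (_++ fill n' lo d ++ replicate b lo) (replicate-split v n≤n') ⟩
  (replicate n v ++ replicate (n' ∸ n) v) ++ fill n' lo d ++ replicate b lo ≡⟨ ++-assoc (replicate n v) _ _ ⟩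
  replicate n v ++ replicate (n' ∸ n) v ++ fill n' lo d ++ replicate b lo ∎)
  where
  open ≡-Reasoning
  v : ℕ
  v = lo + suc d

leadingRun : ℕ → List ℕ → ℕ × List ℕ
leadingRun j [] = 0 , []
leadingRun j (x ∷ xs) = if x ≡ᵇ j then map₁ suc (leadingRun j xs) else (0 , x ∷ xs)

private
  ≡ᵇ-refl : ∀ x → (x ≡ᵇ x) ≡ true
  ≡ᵇ-refl zero = refl
  ≡ᵇ-refl (suc x) = ≡ᵇ-refl x

  <⇒≢ᵇ : ∀ {x y} → x < y → (x ≡ᵇ y) ≡ false
  <⇒≢ᵇ {zero} {suc y} _ = refl
  <⇒≢ᵇ {suc x} {suc y} (s≤s x<y) = <⇒≢ᵇ x<y

leadingRun-replicate : ∀ j a z → HeadBelow j z → leadingRun j (replicate a j ++ z) ≡ (a , z)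
leadingRun-replicate j zero [] _ = refl
leadingRun-replicate j zero (x ∷ z) x<j rewrite <⇒≢ᵇ x<j = refl
leadingRun-replicate j (suc a) z h rewrite ≡ᵇ-refl j | leadingRun-replicate j a z h = refl

-- The digit a of ω^j in δ < ω^k is coded by a block of exponents in [m j, m (j+1)): m j occurs
-- c + a times, and so does each exponent strictly in between, except in the block of the last
-- nonzero digit, where they occur c + a − 1 times; this makes the coding continuous at limits.
module Encoding (k : ℕ) (m : ℕ → ℕ) (c : ℕ) (1≤c : 1 ≤ c)
                (m-step : ∀ j → j < k → m j < m (suc j)) where

  m-mono : ∀ {i j} → i < j → j ≤ k → m i < m j
  m-mono {i} {suc j} (s≤s i≤j) j<k with m≤n⇒m<n∨m≡n i≤j
  ... | inj₁ i<j = <-trans (m-mono i<j (<⇒≤ j<k)) (m-step j j<k)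
  ... | inj₂ refl = m-step i j<k

  m-injective : ∀ {a b} → a < k → b < k → m a ≡ m b → a ≡ b
  m-injective {a} {b} a<k b<k ma≡mb with <-cmp a b
  ... | tri< a<b _ _ = ⊥-elim (<-irrefl ma≡mb (m-mono a<b (<⇒≤ b<k)))
  ... | tri≈ _ a≡b _ = a≡b
  ... | tri> _ _ b<a = ⊥-elim (<-irrefl (sym ma≡mb) (m-mono b<a (<⇒≤ a<k)))

  gap : ℕ → ℕ
  gap j = m (suc j) ∸ suc (m j)

  m+gap : ∀ j → j < k → suc (m j + gap j) ≡ m (suc j)
  m+gap j j<k = m+[n∸m]≡n (m-step j j<k)

  block : ℕ → ℕ → ℕ → List ℕ
  block j n b = fill n (m j) (gap j) ++ replicate b (m j)

  mutual
    encode : ℕ → List ℕ → List ℕ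
    encode zero _ = []
    encode (suc j) ds = level j (proj₁ (leadingRun j ds)) (proj₂ (leadingRun j ds))

    level : ℕ → ℕ → List ℕ → List ℕ
    level zero a _ = block 0 (c + a) (c + a)
    level (suc j) (suc a) [] = block (suc j) (c + a) (c + suc a)
    level (suc j) a z = block (suc j) (c + a) (c + a) ++ encode (suc j) z

  encode-level : ∀ j a z → HeadBelow j z → encode (suc j) (replicate a j ++ z) ≡ level j a z
  encode-level j a z h rewrite leadingRun-replicate j a z h = refl

  data LevelShape (j a : ℕ) (z : List ℕ) : Set where
    continues : level j a z ≡ block j (c + a) (c + a) ++ encode j z → LevelShape j a z
    stops : ∀ {a'} → a ≡ suc a' → z ≡ [] → level j a z ≡ block j (c + a') (c + a) ++ [] →
            LevelShape j a z

  levelShape : ∀ j a z → LevelShape j a z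
  levelShape zero a z = continues (sym (++-identityʳ _))
  levelShape (suc j) zero z = continues refl
  levelShape (suc j) (suc a) [] = stops refl refl (sym (++-identityʳ _))
  levelShape (suc j) (suc a) (x ∷ z) = continues refl

  level-continues : ∀ j a z → z ≢ [] → level j a z ≡ block j (c + a) (c + a) ++ encode j z
  level-continues zero a z _ = sym (++-identityʳ _)
  level-continues (suc j) zero z _ = refl
  level-continues (suc j) (suc a) [] z≢[] = ⊥-elim (z≢[] refl)
  level-continues (suc j) (suc a) (x ∷ z) _ = refl

  block-range : ∀ j n b → j < k → All (λ y → m j ≤ y × y < m (suc j)) (block j n b)
  block-range j n b j<k = ++⁺
    (All.map (λ (lo<y , y≤) → <⇒≤ lo<y , ≤-<-trans y≤ (≤-reflexive (m+gap j j<k))) (fill-bounds n (m j) (gap j)))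
    (replicate⁺ b (≤-refl , m-step j j<k))

  Sorted-block : ∀ j n b → Sorted (block j n b)
  Sorted-block j n b = Sorted-++ (fill n (m j) (gap j)) (replicate b (m j))
    (Sorted-fill n (m j) (gap j)) (Sorted-replicate b (m j))
    (All.map (λ (lo<y , _) → <⇒≤ lo<y) (fill-bounds n (m j) (gap j)))
    (HeadBelow-replicate b ≤-refl)

  encode-below : ∀ j → j ≤ k → ∀ ds → All (_< m j) (encode j ds)
  encode-below zero _ ds = []
  encode-below (suc j) j<k ds with levelShape j (proj₁ (leadingRun j ds)) (proj₂ (leadingRun j ds))
  ... | continues eq = subst (All (_< m (suc j))) (sym eq) (++⁺ (All.map proj₂ (block-range j _ _ j<k))
          (All.map (λ y< → <-trans y< (m-step j j<k)) (encode-below j (<⇒≤ j<k) _)))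
  ... | stops _ _ eq = subst (All (_< m (suc j))) (sym eq) (++⁺ (All.map proj₂ (block-range j _ _ j<k)) [])

  Sorted-block-++ : ∀ j n b X → j < k → Sorted X → All (_< m j) X → Sorted (block j n b ++ X)
  Sorted-block-++ j n b X j<k sX X<mj = Sorted-++ (block j n b) X (Sorted-block j n b) sX
    (All.map proj₁ (block-range j n b j<k)) (HeadBelow-mono X (n≤1+n _) (All<⇒HeadBelow X<mj))

  Sorted-encode : ∀ j → j ≤ k → ∀ ds → Sorted (encode j ds)
  Sorted-encode zero _ ds = []
  Sorted-encode (suc j) j<k ds with levelShape j (proj₁ (leadingRun j ds)) (proj₂ (leadingRun j ds))
  ... | continues eq = subst Sorted (sym eq)
          (Sorted-block-++ j _ _ _ j<k (Sorted-encode j (<⇒≤ j<k) _) (encode-below j (<⇒≤ j<k) _))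
  ... | stops _ _ eq = subst Sorted (sym eq) (Sorted-block-++ j _ _ [] j<k [] [])

  block-≢[] : ∀ j n b X → 1 ≤ b → block j n b ++ X ≢ []
  block-≢[] j n b X 1≤b rewrite ++-assoc (fill n (m j) (gap j)) (replicate b (m j)) X =
    ++-≢[] (fill n (m j) (gap j)) (run-≢[] b X 1≤b)

  encode-≢[] : ∀ j ds → 1 ≤ j → encode j ds ≢ []
  encode-≢[] (suc j) ds _ with levelShape j (proj₁ (leadingRun j ds)) (proj₂ (leadingRun j ds))
  ... | continues eq = subst (_≢ []) (sym eq) (block-≢[] j _ _ _ (≤-trans 1≤c (m≤m+n c _)))
  ... | stops _ _ eq = subst (_≢ []) (sym eq) (block-≢[] j _ _ _ (≤-trans 1≤c (m≤m+n c _)))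

  ltL-block : ∀ j {n n' b b'} X Y → n ≤ n' → All (_< m j) X → (b < b' ⊎ (b ≡ b' × ltL X Y)) →
              ltL (block j n b ++ X) (block j n' b' ++ Y)
  ltL-block j {n} {n'} {b} {b'} X Y n≤n' X<mj cmp
    rewrite ++-assoc (fill n (m j) (gap j)) (replicate b (m j)) X
          | ++-assoc (fill n' (m j) (gap j)) (replicate b' (m j)) Y =
    ltL-fill (m j) (gap j) _ _ n≤n' (HeadBelow-run b X (All<⇒HeadBelow X<mj)) (runs cmp)
    where
    runs : (b < b' ⊎ (b ≡ b' × ltL X Y)) → ltL (replicate b (m j) ++ X) (replicate b' (m j) ++ Y)
    runs (inj₁ b<b') = ltL-longerRun X Y b<b' (All<⇒HeadBelow X<mj)
    runs (inj₂ (refl , X<Y)) = ltL-++⁺ (replicate b (m j)) X<Y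

  level-asBlock : ∀ j a z → j < k → Σ ℕ λ n → Σ (List ℕ) λ X →
    (level j a z ≡ block j n (c + a) ++ X) × n ≤ c + a × c + a ≤ suc n × All (_< m j) X
  level-asBlock j a z j<k with levelShape j a z
  ... | continues eq = c + a , encode j z , eq , ≤-refl , n≤1+n _ , encode-below j (<⇒≤ j<k) z
  ... | stops {a'} refl _ eq = c + a' , [] , eq , +-monoʳ-≤ c (n≤1+n a') , ≤-reflexive (+-suc c a') , []

  EncodeMono : ℕ → Set
  EncodeMono j = ∀ ds ds' → Sorted ds → Sorted ds' → HeadBelow j ds → HeadBelow j ds' →
                 ltL ds ds' → ltL (encode j ds) (encode j ds')

  level-mono : ∀ j → j < k → EncodeMono j → ∀ a a' z z' → Sorted z → Sorted z' →
               HeadBelow j z → HeadBelow j z' → a < a' ⊎ (a ≡ a' × ltL z z') →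
               ltL (level j a z) (level j a' z')
  level-mono j j<k _ a a' z z' _ _ _ _ (inj₁ a<a')
    with level-asBlock j a z j<k | level-asBlock j a' z' j<k
  ... | n , X , eq , n≤ , _ , X< | n' , X' , eq' , _ , ≤suc-n' , _ = subst₂ ltL (sym eq) (sym eq')
      (ltL-block j X X' (≤-trans n≤ (≤-pred (≤-trans (+-monoʳ-< c a<a') ≤suc-n'))) X< (inj₁ (+-monoʳ-< c a<a')))
  level-mono j j<k mono a .a z z' sz sz' hz hz' (inj₂ (refl , z<z')) with z' | levelShape j a z'
  ... | [] | _ = ⊥-elim (ltL-[]ʳ z z<z')
  ... | x' ∷ z'' | stops _ () _
  ... | x' ∷ z'' | continues eq' with levelShape j a z
  ...   | continues eq = subst₂ ltL (sym eq) (sym eq')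
          (ltL-block j _ _ ≤-refl (encode-below j (<⇒≤ j<k) z) (inj₂ (refl , mono z (x' ∷ z'') sz sz' hz hz' z<z')))
  ...   | stops {a''} refl refl eq = subst₂ ltL (sym eq) (sym eq')
          (ltL-block j [] _ (+-monoʳ-≤ c (n≤1+n a'')) [] (inj₂ (refl , ≢[]⇒ltL-[] _ (encode-≢[] j _ (≤-trans (s≤s z≤n) hz')))))

  encode-mono : ∀ j → j ≤ k → EncodeMono j
  encode-mono zero _ [] [] _ _ _ _ ()
  encode-mono zero _ [] (_ ∷ _) _ _ _ () _
  encode-mono zero _ (_ ∷ _) _ _ _ () _ _
  encode-mono (suc j) j<k ds ds' s s' h h' ds<ds'
    with splitRun j ds s h | splitRun j ds' s' h'
  ... | a , z , refl , hz , sz | a' , z' , refl , hz' , sz'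
    rewrite encode-level j a z hz | encode-level j a' z' hz' =
    level-mono j j<k (encode-mono j (<⇒≤ j<k)) a a' z z' sz sz' hz hz' (ltL-run⁻ a a' z z' hz hz' ds<ds')

  count-block-below : ∀ γ j n b X → j < k → γ < m j → count γ (block j n b ++ X) ≡ count γ X
  count-block-below γ j n b X j<k γ<mj = trans (count-++ γ (block j n b) X)
    (cong (_+ count γ X) (count-above γ (All.map (λ (mj≤y , _) → <-≤-trans γ<mj mj≤y) (block-range j n b j<k))))

  count-block-bottom : ∀ j n b X → All (_< m j) X → count (m j) (block j n b ++ X) ≡ b
  count-block-bottom j n b X X<mj = begin
    count (m j) ((filler ++ replicate b (m j)) ++ X)       ≡⟨ cong (count (m j)) (++-assoc filler (replicate b (m j)) X) ⟩
    count (m j) (filler ++ replicate b (m j) ++ X)         ≡⟨ count-++ (m j) filler _ ⟩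
    count (m j) filler + count (m j) (replicate b (m j) ++ X) ≡⟨ cong₂ _+_ fill-none (count-run (m j) b X X<mj) ⟩
    b                                                  ∎
    where
    open ≡-Reasoning
    filler : List ℕ
    filler = fill n (m j) (gap j)
    fill-none : count (m j) filler ≡ 0
    fill-none = count-above (m j) (All.map proj₁ (fill-bounds n (m j) (gap j)))

  count-block-gap : ∀ γ j n b X → j < k → m j < γ → γ < m (suc j) → All (_< m j) X →
                    count γ (block j n b ++ X) ≡ n
  count-block-gap γ j n b X j<k mj<γ γ< X<mj = begin
    count γ ((filler ++ replicate b (m j)) ++ X)       ≡⟨ cong (count γ) (++-assoc filler (replicate b (m j)) X) ⟩
    count γ (filler ++ replicate b (m j) ++ X)         ≡⟨ count-++ γ filler _ ⟩
    count γ filler + count γ (replicate b (m j) ++ X)  ≡⟨ cong₂ _+_ fill-all rest-none ⟩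
    n + 0                                         ≡⟨ +-identityʳ n ⟩
    n                                             ∎
    where
    open ≡-Reasoning
    filler : List ℕ
    filler = fill n (m j) (gap j)
    fill-all : count γ filler ≡ n
    fill-all = count-fill γ n (m j) (gap j) mj<γ (≤-pred (subst (γ <_) (sym (m+gap j j<k)) γ<))
    rest-none : count γ (replicate b (m j) ++ X) ≡ 0
    rest-none = count-below γ (++⁺ (replicate⁺ b mj<γ) (All.map (λ y< → <-trans y< mj<γ) X<mj))

  count-encode : ∀ j → j ≤ k → ∀ i → i < j → ∀ ds → Sorted ds → HeadBelow j ds →
                 count (m i) (encode j ds) ∸ c ≡ count i ds
  count-encode (suc j) j<k i (s≤s i≤j) ds s h with splitRun j ds s h
  ... | a , z , refl , hz , sz = trans (cong (λ xs → count (m i) xs ∸ c) (encode-level j a z hz)) (at-level (m≤n⇒m<n∨m≡n i≤j))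
    where
    at-level : i < j ⊎ i ≡ j → count (m i) (level j a z) ∸ c ≡ count i (replicate a j ++ z)
    at-level (inj₂ refl) with level-asBlock i a z j<k
    ... | n , X , eq , _ , _ , X< = begin
      count (m i) (level i a z) ∸ c               ≡⟨ cong (λ xs → count (m i) xs ∸ c) eq ⟩
      count (m i) (block i n (c + a) ++ X) ∸ c    ≡⟨ cong (_∸ c) (count-block-bottom i n (c + a) X X<) ⟩
      c + a ∸ c                                   ≡⟨ m+n∸m≡n c a ⟩
      a                                           ≡⟨ sym (count-run i a z (Sorted⇒All< sz hz)) ⟩
      count i (replicate a i ++ z)                ∎
      where open ≡-Reasoning
    at-level (inj₁ i<j) with levelShape j a z
    ... | continues eq = begin
      count (m i) (level j a z) ∸ c                                ≡⟨ cong (λ xs → count (m i) xs ∸ c) eq ⟩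
      count (m i) (block j (c + a) (c + a) ++ encode j z) ∸ c      ≡⟨ cong (_∸ c) (count-block-below (m i) j _ _ _ j<k mi<mj) ⟩
      count (m i) (encode j z) ∸ c                                 ≡⟨ count-encode j (<⇒≤ j<k) i i<j z sz hz ⟩
      count i z                                                    ≡⟨ sym (count-skipRun i a z i<j) ⟩
      count i (replicate a j ++ z)                                 ∎
      where
      open ≡-Reasoning
      mi<mj : m i < m j
      mi<mj = m-mono i<j (<⇒≤ j<k)
    ... | stops {a'} _ refl eq = begin
      count (m i) (level j a []) ∸ c                               ≡⟨ cong (λ xs → count (m i) xs ∸ c) eq ⟩
      count (m i) (block j (c + a') (c + a) ++ []) ∸ c             ≡⟨ cong (_∸ c) (count-block-below (m i) j _ _ [] j<k (m-mono i<j (<⇒≤ j<k))) ⟩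
      0 ∸ c                                                        ≡⟨ 0∸n≡0 c ⟩
      0                                                            ≡⟨ sym (count-skipRun i a [] i<j) ⟩
      count i (replicate a j ++ [])                                ∎
      where open ≡-Reasoning

  lastL-block : ∀ j n b X → 1 ≤ b → lastL (block j n b ++ X) ≡ lastL (m j ∷ X)
  lastL-block j n (suc b) X _ = begin
    lastL ((fill n (m j) (gap j) ++ replicate (suc b) (m j)) ++ X)  ≡⟨ cong lastL (++-assoc (fill n (m j) (gap j)) _ X) ⟩
    lastL (fill n (m j) (gap j) ++ m j ∷ replicate b (m j) ++ X)    ≡⟨ lastL-++ (fill n (m j) (gap j)) (m j) _ ⟩
    lastL (replicate (suc b) (m j) ++ X)                            ≡⟨ lastL-run b X ⟩
    lastL (m j ∷ X)                                                 ∎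
    where
    open ≡-Reasoning
    lastL-run : ∀ b {v} X → lastL (replicate (suc b) v ++ X) ≡ lastL (v ∷ X)
    lastL-run zero X = refl
    lastL-run (suc b) X = lastL-run b X

  private
    1≤c+ : ∀ a → 1 ≤ c + a
    1≤c+ a = ≤-trans 1≤c (m≤m+n c a)

    lastL-zeros-run : ∀ a → lastL (replicate a 0 ++ []) ≡ 0
    lastL-zeros-run zero = refl
    lastL-zeros-run (suc zero) = refl
    lastL-zeros-run (suc (suc a)) = lastL-zeros-run (suc a)

  EncodeLast : ℕ → Set
  EncodeLast j = ∀ ds → Sorted ds → HeadBelow j ds → lastL (encode j ds) ≡ m (lastL ds)

  level-last : ∀ j → (1 ≤ j → EncodeLast j) → ∀ a z → Sorted z → HeadBelow j z →
               lastL (level j a z) ≡ m (lastL (replicate a j ++ z))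
  level-last zero _ a [] _ _ = begin
    lastL (block 0 (c + a) (c + a))         ≡⟨ cong lastL (sym (++-identityʳ (block 0 (c + a) (c + a)))) ⟩
    lastL (block 0 (c + a) (c + a) ++ [])   ≡⟨ lastL-block 0 (c + a) (c + a) [] (1≤c+ a) ⟩
    m 0                                     ≡⟨ cong m (sym (lastL-zeros-run a)) ⟩
    m (lastL (replicate a 0 ++ []))         ∎
    where open ≡-Reasoning
  level-last (suc j) last zero z sz hz = begin
    lastL (block (suc j) (c + 0) (c + 0) ++ encode (suc j) z)  ≡⟨ lastL-block (suc j) _ _ _ (1≤c+ 0) ⟩
    lastL (m (suc j) ∷ encode (suc j) z)   ≡⟨ lastL-++-≢[] [ _ ] _ (encode-≢[] (suc j) z (s≤s z≤n)) ⟩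
    lastL (encode (suc j) z)               ≡⟨ last (s≤s z≤n) z sz hz ⟩
    m (lastL z)                            ∎
    where open ≡-Reasoning
  level-last (suc j) _ (suc a) [] _ _ = begin
    lastL (block (suc j) (c + a) (c + suc a))        ≡⟨ cong lastL (sym (++-identityʳ (block (suc j) (c + a) (c + suc a)))) ⟩
    lastL (block (suc j) (c + a) (c + suc a) ++ [])  ≡⟨ lastL-block (suc j) (c + a) (c + suc a) [] (1≤c+ (suc a)) ⟩
    m (suc j)                                        ≡⟨ cong m (sym (lastL-replicate a (suc j))) ⟩
    m (lastL (replicate (suc a) (suc j)))            ≡⟨ cong (λ xs → m (lastL xs)) (sym (++-identityʳ (replicate (suc a) (suc j)))) ⟩
    m (lastL (replicate (suc a) (suc j) ++ []))      ∎
    where open ≡-Reasoning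
  level-last (suc j) last (suc a) (x ∷ z) sz hz = begin
    lastL (block (suc j) (c + suc a) (c + suc a) ++ encode (suc j) (x ∷ z))  ≡⟨ lastL-block (suc j) _ _ _ (1≤c+ (suc a)) ⟩
    lastL (m (suc j) ∷ encode (suc j) (x ∷ z))    ≡⟨ lastL-++-≢[] [ _ ] _ (encode-≢[] (suc j) (x ∷ z) (s≤s z≤n)) ⟩
    lastL (encode (suc j) (x ∷ z))                ≡⟨ last (s≤s z≤n) (x ∷ z) sz hz ⟩
    m (lastL (x ∷ z))                             ≡⟨ cong m (sym (lastL-++ (replicate (suc a) (suc j)) x z)) ⟩
    m (lastL (replicate (suc a) (suc j) ++ x ∷ z)) ∎
    where open ≡-Reasoning

  encode-last : ∀ j → j ≤ k → 1 ≤ j → EncodeLast j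
  encode-last (suc j) j<k _ ds s h with splitRun j ds s h
  ... | a , z , refl , hz , sz = trans (cong lastL (encode-level j a z hz))
        (level-last j (encode-last j (<⇒≤ j<k)) a z sz hz)

  Dense : ℕ → ℕ → ℕ → List ℕ → Set
  Dense r lo hi xs = ∀ γ → lo ≤ γ → γ < hi → r ≤ count γ xs

  Dense-block : ∀ j n b X r → j < k → r ≤ n → r ≤ b → All (_< m j) X →
                Dense r (m j) (m (suc j)) (block j n b ++ X)
  Dense-block j n b X r j<k r≤n r≤b X<mj γ mj≤γ γ< with m≤n⇒m<n∨m≡n mj≤γ
  ... | inj₂ refl = subst (r ≤_) (sym (count-block-bottom j n b X X<mj)) r≤b
  ... | inj₁ mj<γ = subst (r ≤_) (sym (count-block-gap γ j n b X j<k mj<γ γ< X<mj)) r≤n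

  Dense-join : ∀ j n b X r lo → j < k → Dense r lo (m j) X →
                      Dense r (m j) (m (suc j)) (block j n b ++ X) → Dense r lo (m (suc j)) (block j n b ++ X)
  Dense-join j n b X r lo j<k below above γ lo≤γ γ< with m j ≤? γ
  ... | yes mj≤γ = above γ mj≤γ γ<
  ... | no mj≰γ = subst (r ≤_) (sym (count-block-below γ j n b X j<k (≰⇒> mj≰γ))) (below γ lo≤γ (≰⇒> mj≰γ))

  -- Satisfied by the members of F(ω^k)^r_i, and by every δ when r < c.
  RichHyp : ℕ → ℕ → List ℕ → Set
  RichHyp r j ds = ∀ i → lastL ds ≤ i → i < j → r < c + count i ds

  Rich : ℕ → ℕ → ℕ → List ℕ → Set
  Rich r t hi xs = Dense r (m t) hi xs × r < count (m t) xs

  EncodeRich : ℕ → Set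
  EncodeRich j = ∀ ds r → Sorted ds → HeadBelow j ds → RichHyp r j ds → Rich r (lastL ds) (m j) (encode j ds)

  level-rich-bottom : ∀ j n b r → j < k → r ≤ n → r < b → Rich r j (m (suc j)) (block j n b)
  level-rich-bottom j n b r j<k r≤n r<b =
    subst (Dense r (m j) (m (suc j))) B++[] (Dense-block j n b [] r j<k r≤n (<⇒≤ r<b) []) ,
    subst (λ xs → r < count (m j) xs) B++[] (subst (r <_) (sym (count-block-bottom j n b [] [])) r<b)
    where
    B++[] : block j n b ++ [] ≡ block j n b
    B++[] = ++-identityʳ (block j n b)

  level-rich-continues : ∀ j b z r → suc j < k → EncodeRich (suc j) → Sorted z → HeadBelow (suc j) z →
    r ≤ b → RichHyp r (suc j) z → Rich r (lastL z) (m (suc (suc j))) (block (suc j) b b ++ encode (suc j) z)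
  level-rich-continues j b z r j<k rich sz hz r≤b hyp with rich z r sz hz hyp
  ... | dense , strict =
    Dense-join (suc j) b b _ r _ j<k dense (Dense-block (suc j) b b _ r j<k r≤b r≤b (encode-below (suc j) (<⇒≤ j<k) z)) ,
    subst (r <_) (sym (count-block-below _ (suc j) b b _ j<k (m-mono (lastL-< z (s≤s z≤n) sz hz) (<⇒≤ j<k)))) strict

  level-rich : ∀ j → j < k → (1 ≤ j → EncodeRich j) → ∀ a z r → Sorted z → HeadBelow j z →
    RichHyp r (suc j) (replicate a j ++ z) → Rich r (lastL (replicate a j ++ z)) (m (suc j)) (level j a z)
  level-rich zero j<k _ a [] r _ _ hyp = subst (λ t → Rich r t (m 1) (level 0 a [])) (sym (lastL-zeros-run a)) (
    level-rich-bottom 0 (c + a) (c + a) r j<k (<⇒≤ r<) r<)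
    where
    r< : r < c + a
    r< = subst (λ n → r < c + n) (count-run 0 a [] []) (hyp 0 (≤-reflexive (lastL-zeros-run a)) (s≤s z≤n))
  level-rich (suc j) j<k rich zero z r sz hz hyp =
    level-rich-continues j (c + 0) z r j<k (rich (s≤s z≤n)) sz hz (<⇒≤ r<) (λ i t≤i i< → hyp i t≤i (m≤n⇒m≤1+n i<))
    where
    r< : r < c + 0
    r< = subst (λ n → r < c + n) (count-below (suc j) (Sorted⇒All< sz hz))
           (hyp (suc j) (<⇒≤ (lastL-< z (s≤s z≤n) sz hz)) ≤-refl)
  level-rich (suc j) j<k _ (suc a) [] r _ _ hyp = subst (λ t → Rich r t (m (suc (suc j))) (level (suc j) (suc a) [])) (sym last≡)
    (level-rich-bottom (suc j) (c + a) (c + suc a) r j<k (≤-pred (subst (r <_) (+-suc c a) r<)) r<)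
    where
    last≡ : lastL (replicate (suc a) (suc j) ++ []) ≡ suc j
    last≡ = trans (cong lastL (++-identityʳ (replicate (suc a) (suc j)))) (lastL-replicate a (suc j))
    r< : r < c + suc a
    r< = subst (λ n → r < c + n) (count-run (suc j) (suc a) [] []) (hyp (suc j) (≤-reflexive last≡) ≤-refl)
  level-rich (suc j) j<k rich (suc a) (x ∷ z) r sz hz hyp =
    subst (λ t → Rich r t (m (suc (suc j))) (level (suc j) (suc a) (x ∷ z))) (sym (lastL-++ (replicate (suc a) (suc j)) x z)) $
    level-rich-continues j (c + suc a) (x ∷ z) r j<k (rich (s≤s z≤n)) sz hz (<⇒≤ r<) hyp'
    where
    r< : r < c + suc a
    r< = subst (λ n → r < c + n) (count-run (suc j) (suc a) (x ∷ z) (Sorted⇒All< sz hz))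
           (hyp (suc j) (subst (_≤ suc j) (sym (lastL-++ (replicate (suc a) (suc j)) x z))
             (<⇒≤ (lastL-< (x ∷ z) (s≤s z≤n) sz hz))) ≤-refl)
    hyp' : RichHyp r (suc j) (x ∷ z)
    hyp' i t≤i i< = subst (λ n → r < c + n) (count-skipRun i (suc a) (x ∷ z) i<)
      (hyp i (subst (_≤ i) (sym (lastL-++ (replicate (suc a) (suc j)) x z)) t≤i) (m≤n⇒m≤1+n i<))

  encode-rich : ∀ j → j ≤ k → 1 ≤ j → EncodeRich j
  encode-rich (suc j) j<k _ ds r s h hyp with splitRun j ds s h
  ... | a , z , refl , hz , sz rewrite encode-level j a z hz =
    level-rich j j<k (encode-rich j (<⇒≤ j<k)) a z r sz hz hyp

  encode-continues : ∀ j a z → HeadBelow j z → z ≢ [] →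
                     encode (suc j) (replicate a j ++ z) ≡ block j (c + a) (c + a) ++ encode j z
  encode-continues j a z h z≢[] = trans (encode-level j a z h) (level-continues j a z z≢[])

  block-∷ʳ : ∀ j n b → block j n (suc b) ≡ block j n b ++ [ m j ]
  block-∷ʳ j n b = begin
    fill n (m j) (gap j) ++ replicate (suc b) (m j)       ≡⟨ cong (fill n (m j) (gap j) ++_) (replicate-∷ʳ b) ⟩
    fill n (m j) (gap j) ++ replicate b (m j) ++ [ m j ]  ≡⟨ sym (++-assoc (fill n (m j) (gap j)) _ _) ⟩
    block j n b ++ [ m j ]                                ∎
    where
    open ≡-Reasoning
    replicate-∷ʳ : ∀ b {v : ℕ} → replicate (suc b) v ≡ replicate b v ++ [ v ]
    replicate-∷ʳ zero = refl
    replicate-∷ʳ (suc b) = cong (_ ∷_) (replicate-∷ʳ b)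

  private
    runWidth : ℕ → ℕ → ℕ
    runWidth zero N = c + suc N
    runWidth (suc _) N = c + N

    level-run : ∀ t N → level t (suc N) [] ≡ block t (runWidth t N) (c + suc N)
    level-run zero N = refl
    level-run (suc _) N = refl

    c+N≤runWidth : ∀ t N → c + N ≤ runWidth t N
    c+N≤runWidth zero N = +-monoʳ-≤ c (n≤1+n N)
    c+N≤runWidth (suc _) N = ≤-refl

  encode-run : ∀ t N → Σ (List ℕ) λ W → encode (suc t) (replicate (suc N) t) ≡ replicate (c + N) (m t + gap t) ++ W
  encode-run t N with fill-prefix (c + N) (runWidth t N) (c + suc N) (m t) (gap t) (c+N≤runWidth t N) (+-monoʳ-≤ c (n≤1+n N))
  ... | W , eq = W , (begin
    encode (suc t) (replicate (suc N) t)          ≡⟨ cong (encode (suc t)) (sym (++-identityʳ (replicate (suc N) t))) ⟩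
    encode (suc t) (replicate (suc N) t ++ [])    ≡⟨ encode-level t (suc N) [] tt ⟩
    level t (suc N) []                            ≡⟨ level-run t N ⟩
    block t (runWidth t N) (c + suc N)            ≡⟨ eq ⟩
    replicate (c + N) (m t + gap t) ++ W          ∎)
    where open ≡-Reasoning

  -- The code of y + ω^(t+1) is the supremum of the codes of y + ω^t·(N+1).
  Limit : ℕ → List ℕ → ℕ → Set
  Limit j y t = Σ (List ℕ) λ P → (encode j (y ++ [ suc t ]) ≡ P ++ [ m (suc t) ]) ×
    (∀ N → Σ (List ℕ) λ W → encode j (y ++ replicate (suc N) t) ≡ P ++ replicate (c + N) (m t + gap t) ++ W)

  private
    limit-base : ∀ a t → Limit (suc (suc t)) (replicate a (suc t) ++ []) t
    limit-base a t = block (suc t) (c + a) (c + a) , (begin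
      encode (suc (suc t)) ((replicate a (suc t) ++ []) ++ [ suc t ])
        ≡⟨ cong (λ xs → encode (suc (suc t)) (xs ++ [ suc t ])) (++-identityʳ (replicate a (suc t))) ⟩
      encode (suc (suc t)) (replicate a (suc t) ++ [ suc t ])
        ≡⟨ cong (encode (suc (suc t))) (snoc a) ⟩
      encode (suc (suc t)) (replicate (suc a) (suc t) ++ [])
        ≡⟨ encode-level (suc t) (suc a) [] tt ⟩
      block (suc t) (c + a) (c + suc a)
        ≡⟨ cong (block (suc t) (c + a)) (+-suc c a) ⟩
      block (suc t) (c + a) (suc (c + a))
        ≡⟨ block-∷ʳ (suc t) (c + a) (c + a) ⟩
      block (suc t) (c + a) (c + a) ++ [ m (suc t) ] ∎) ,
      λ N → let (W , eq) = encode-run t N in W , (begin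
        encode (suc (suc t)) ((replicate a (suc t) ++ []) ++ replicate (suc N) t)
          ≡⟨ cong (λ xs → encode (suc (suc t)) (xs ++ replicate (suc N) t)) (++-identityʳ (replicate a (suc t))) ⟩
        encode (suc (suc t)) (replicate a (suc t) ++ replicate (suc N) t)
          ≡⟨ encode-continues (suc t) a (replicate (suc N) t) ≤-refl (λ ()) ⟩
        block (suc t) (c + a) (c + a) ++ encode (suc t) (replicate (suc N) t)
          ≡⟨ cong (block (suc t) (c + a) (c + a) ++_) eq ⟩
        block (suc t) (c + a) (c + a) ++ replicate (c + N) (m t + gap t) ++ W ∎)
      where
      open ≡-Reasoning
      snoc : ∀ a {v : ℕ} → replicate a v ++ [ v ] ≡ replicate (suc a) v ++ []
      snoc zero = refl
      snoc (suc a) = cong (_ ∷_) (snoc a)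

    limit-step : ∀ j a y t → HeadBelow j y → suc t < j → Limit j y t → Limit (suc j) (replicate a j ++ y) t
    limit-step j a y t hy t<j (P , eq , eqN) = block j (c + a) (c + a) ++ P , (begin
      encode (suc j) ((replicate a j ++ y) ++ [ suc t ])  ≡⟨ cong (encode (suc j)) (++-assoc (replicate a j) y _) ⟩
      encode (suc j) (replicate a j ++ y ++ [ suc t ])    ≡⟨ encode-continues j a _ (HeadBelow-++ y _ hy t<j) (++-≢[] y (λ ())) ⟩
      block j (c + a) (c + a) ++ encode j (y ++ [ suc t ]) ≡⟨ cong (block j (c + a) (c + a) ++_) eq ⟩
      block j (c + a) (c + a) ++ P ++ [ m (suc t) ]        ≡⟨ sym (++-assoc (block j (c + a) (c + a)) P _) ⟩
      (block j (c + a) (c + a) ++ P) ++ [ m (suc t) ]      ∎) ,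
      λ N → let (W , eqW) = eqN N in W , (begin
        encode (suc j) ((replicate a j ++ y) ++ replicate (suc N) t)
          ≡⟨ cong (encode (suc j)) (++-assoc (replicate a j) y _) ⟩
        encode (suc j) (replicate a j ++ y ++ replicate (suc N) t)
          ≡⟨ encode-continues j a _ (HeadBelow-++ y _ hy (<-trans (n<1+n t) t<j)) (++-≢[] y (λ ())) ⟩
        block j (c + a) (c + a) ++ encode j (y ++ replicate (suc N) t)
          ≡⟨ cong (block j (c + a) (c + a) ++_) eqW ⟩
        block j (c + a) (c + a) ++ P ++ replicate (c + N) (m t + gap t) ++ W
          ≡⟨ sym (++-assoc (block j (c + a) (c + a)) P _) ⟩
        (block j (c + a) (c + a) ++ P) ++ replicate (c + N) (m t + gap t) ++ W ∎)
      where open ≡-Reasoning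

  encode-limit : ∀ j → j ≤ k → ∀ y t → Sorted (y ++ [ suc t ]) → HeadBelow j (y ++ [ suc t ]) → Limit j y t
  encode-limit zero _ [] t _ ()
  encode-limit zero _ (_ ∷ _) t _ ()
  encode-limit (suc j) j<k y t s h with Sorted⇒All< s h
  ... | all< with ++⁻ʳ y all<
  ...   | s≤s t<j ∷ [] with splitRun j y (Sorted-++⁻ˡ y s) (HeadBelow-++⁻ˡ y h (s≤s t<j))
  ...     | a , y' , refl , hy' , _ with m≤n⇒m<n∨m≡n t<j | y'
  ...       | inj₂ refl | [] = limit-base a t
  ...       | inj₂ refl | x ∷ _ = ⊥-elim (<-irrefl refl (<-≤-trans hy' x≥))
    where
    x≥ : suc t ≤ x
    x≥ with ++⁻ʳ (replicate a (suc t)) (Sorted-∷ʳ⇒All≥ _ (suc t) s)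
    ... | x≥ ∷ _ = x≥
  ...       | inj₁ t+1<j | y'' = limit-step j a y'' t hy' t+1<j
             (encode-limit j (<⇒≤ j<k) y'' t (Sorted-++⁻ʳ (replicate a j) (subst Sorted (++-assoc (replicate a j) y'' _) s))
               (HeadBelow-++ y'' _ hy' t+1<j))

-- The closed copy of ω^k in T(θ)

digits : ℕ → (ℕ → ℕ) → List ℕ
digits zero f = []
digits (suc j) f = replicate (f j) j ++ digits j f

digits-below : ∀ j f → All (_< j) (digits j f)
digits-below zero f = []
digits-below (suc j) f = ++⁺ (replicate⁺ (f j) ≤-refl) (All.map (λ i<j → m≤n⇒m≤1+n i<j) (digits-below j f))

Sorted-digits : ∀ j f → Sorted (digits j f)
Sorted-digits zero f = []
Sorted-digits (suc j) f = Sorted-++ (replicate (f j) j) (digits j f) (Sorted-replicate (f j) j)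
  (Sorted-digits j f) (replicate⁺ (f j) ≤-refl) (HeadBelow-mono (digits j f) (n≤1+n j) (All<⇒HeadBelow (digits-below j f)))

digits-cong : ∀ j f g → (∀ i → i < j → f i ≡ g i) → digits j f ≡ digits j g
digits-cong zero f g _ = refl
digits-cong (suc j) f g f≗g = cong₂ (λ a ds → replicate a j ++ ds) (f≗g j ≤-refl)
  (digits-cong j f g (λ i i<j → f≗g i (m≤n⇒m≤1+n i<j)))

digits-count : ∀ j ds → Sorted ds → HeadBelow j ds → digits j (λ i → count i ds) ≡ ds
digits-count zero [] _ _ = refl
digits-count (suc j) ds s h with splitRun j ds s h
... | a , z , refl , hz , sz = cong₂ _++_ (cong (λ a → replicate a j) (count-run j a z (Sorted⇒All< sz hz)))
      (trans (digits-cong j _ _ (λ i i<j → count-skipRun i a z i<j)) (digits-count j z sz hz))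

ltL-below-limit : ∀ R lam v → Sorted lam → ltL lam (R ++ [ suc v ]) →
                  Σ ℕ λ N → ∀ n → N < n → ∀ W → ltL lam (R ++ replicate n v ++ W)
ltL-below-limit [] [] v _ _ = 0 , λ { (suc n) _ W → tt }
ltL-below-limit [] (x ∷ []) v _ (inj₂ (_ , ()))
ltL-below-limit [] (x ∷ _ ∷ _) v _ (inj₂ (_ , ()))
ltL-below-limit [] (x ∷ xs) v s (inj₁ x≤v) with splitRun v (x ∷ xs) s x≤v
... | a , z , eq , hz , _ = a , λ n a<n W → subst (λ ys → ltL ys (replicate n v ++ W)) (sym eq) (ltL-longerRun z W a<n hz)
ltL-below-limit (r ∷ R) [] v _ _ = 0 , λ _ _ _ → tt
ltL-below-limit (r ∷ R) (x ∷ xs) v _ (inj₁ x<r) = 0 , λ _ _ _ → inj₁ x<r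
ltL-below-limit (r ∷ R) (x ∷ xs) v s (inj₂ (refl , p)) with ltL-below-limit R xs v (Sorted-tail s) p
... | N , below = N , λ n N<n W → inj₂ (refl , below n N<n W)

ltL⇒∷ʳ0-LeL : ∀ ys zs → ltL ys zs → LeL (ys ++ [ 0 ]) zs
ltL⇒∷ʳ0-LeL [] (zero ∷ []) _ = inj₂ refl
ltL⇒∷ʳ0-LeL [] (zero ∷ _ ∷ _) _ = inj₁ (inj₂ (refl , tt))
ltL⇒∷ʳ0-LeL [] (suc z ∷ zs) _ = inj₁ (inj₁ (s≤s z≤n))
ltL⇒∷ʳ0-LeL (y ∷ ys) (z ∷ zs) (inj₁ y<z) = inj₁ (inj₁ y<z)
ltL⇒∷ʳ0-LeL (y ∷ ys) (z ∷ zs) (inj₂ (refl , p)) with ltL⇒∷ʳ0-LeL ys zs p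
... | inj₁ q = inj₁ (inj₂ (refl , q))
... | inj₂ e = inj₂ (cong (y ∷_) e)

module Embedding (θ : Ord) (Q : List ℕ) (θ≡ : exps θ ≡ Q ++ [ CB θ ]) (1≤K : 1 ≤ CB θ)
                 (k : ℕ) (1≤k : 1 ≤ k) (m : ℕ → ℕ) (c : ℕ) (1≤c : 1 ≤ c)
                 (m-step : ∀ j → j < k → m j < m (suc j)) (mk≡K : m k ≡ CB θ) where
  open Encoding k m c 1≤c m-step public
  open Collapse θ Q (CB θ) θ≡ 1≤K

  private
    K : ℕ
    K = CB θ

  encode<K : ∀ ds → All (_< K) (encode k ds)
  encode<K ds = subst (λ v → All (_< v) (encode k ds)) mk≡K (encode-below k ≤-refl ds)

  code : List ℕ → List ℕ
  code ds = Q ++ encode k ds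

  Sorted-code : ∀ ds → Sorted (code ds)
  Sorted-code ds = Sorted-Q++ (encode k ds) (Sorted-encode k ≤-refl ds)
    (HeadBelow-mono (encode k ds) (n≤1+n K) (All<⇒HeadBelow (encode<K ds)))

  embed : Ord → Ord
  embed δ = mkOrd (code (exps δ)) (Sorted-code (exps δ))

  Embedded : Ord → Set
  Embedded x = Σ Ord λ δ → δ <ₒ ωpow k × embed δ ≡ x

  decode : Ord → Ord
  decode x = mkOrd (digits k (λ i → count (m i) (exps x) ∸ c)) (Sorted-digits k _)

  decode-embed : ∀ δ → δ <ₒ ωpow k → decode (embed δ) ≡ δ
  decode-embed δ δ<ω^k = exps-injective (trans (digits-cong k _ _ digit) (digits-count k ds (sorted δ) h))
    where
    ds : List ℕ
    ds = exps δ
    h : HeadBelow k ds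
    h = ltL⇒HeadBelow ds δ<ω^k
    Q-none : ∀ i → i < k → count (m i) Q ≡ 0
    Q-none i i<k = count-above (m i) (All.map (<-≤-trans (subst (m i <_) mk≡K (m-mono i<k ≤-refl))) Q≥K)
    digit : ∀ i → i < k → count (m i) (code ds) ∸ c ≡ count i ds
    digit i i<k = trans (cong (_∸ c) (trans (count-++ (m i) Q (encode k ds)) (cong (_+ count (m i) (encode k ds)) (Q-none i i<k))))
                        (count-encode k ≤-refl i i<k ds (sorted δ) h)

  code-mono : ∀ ds ds' → Sorted ds → Sorted ds' → HeadBelow k ds → HeadBelow k ds' →
              ltL ds ds' → ltL (code ds) (code ds')
  code-mono ds ds' s s' h h' ds<ds' = ltL-++⁺ Q (encode-mono k ≤-refl ds ds' s s' h h' ds<ds')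

  code-mono⁻ : ∀ ds ds' → Sorted ds → Sorted ds' → HeadBelow k ds → HeadBelow k ds' →
               ltL (code ds) (code ds') → ltL ds ds'
  code-mono⁻ ds ds' s s' h h' p with ltL-trichotomy ds ds'
  ... | inj₁ q = q
  ... | inj₂ (inj₁ refl) = ⊥-elim (ltL-irrefl (code ds) p)
  ... | inj₂ (inj₂ q) = ⊥-elim (ltL-asym (code ds) (code ds') p (code-mono ds' ds s' s h' h q))

  code-monoLe : ∀ ds ds' → Sorted ds → Sorted ds' → HeadBelow k ds → HeadBelow k ds' →
                LeL ds ds' → LeL (code ds) (code ds')
  code-monoLe ds ds' s s' h h' (inj₁ ds<ds') = inj₁ (code-mono ds ds' s s' h h' ds<ds')
  code-monoLe ds ds' s s' h h' (inj₂ refl) = inj₂ refl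

  decode-iso : OrdIso Embedded (λ δ → δ <ₒ ωpow k) decode
  decode-iso = into , mono , onto
    where
    into : ∀ x → Embedded x → decode x <ₒ ωpow k
    into x _ = HeadBelow⇒ltL _ (All<⇒HeadBelow (digits-below k _))
    mono : ∀ x y → Embedded x → Embedded y → x <ₒ y → decode x <ₒ decode y
    mono x y (δ , δ< , refl) (δ' , δ'< , refl) x<y =
      subst₂ _<ₒ_ (sym (decode-embed δ δ<)) (sym (decode-embed δ' δ'<))
        (code-mono⁻ _ _ (sorted δ) (sorted δ') (ltL⇒HeadBelow _ δ<) (ltL⇒HeadBelow _ δ'<) x<y)
    onto : ∀ δ → δ <ₒ ωpow k → Σ Ord λ x → Embedded x × (decode x ≡ δ)
    onto δ δ< = embed δ , (δ , δ< , refl) , decode-embed δ δ<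

  -- The closure argument: every λ with code [] ≤ λ < code δ lies in some interval
  -- [code ys, code (ys + 1)), found by descending from δ: at a successor δ = y + 1 step to y,
  -- at a limit δ = y + ω^(t+1) step to some y + ω^t·n, which exists by continuity of encode.
  Bracket : List ℕ → Set
  Bracket lam = Σ (List ℕ) λ ys → Sorted ys × HeadBelow k ys × LeL (code ys) lam × ltL lam (code (ys ++ [ 0 ]))

  StepDown : Ord → List ℕ → Set
  StepDown δ lam = Σ Ord λ δ' → δ' <ₒ δ × HeadBelow k (exps δ') × ltL lam (code (exps δ'))

  private
    init-sorted : ∀ δ y t → exps δ ≡ y ++ [ t ] → Sorted y
    init-sorted δ y t δ≡ = Sorted-++⁻ˡ y (subst Sorted δ≡ (sorted δ))

    init-below : ∀ δ y t → exps δ ≡ y ++ [ t ] → HeadBelow k (exps δ) → HeadBelow k y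
    init-below δ y t δ≡ h = HeadBelow-++⁻ˡ y (subst (HeadBelow k) δ≡ h)
      (All<⇒HeadBelow (++⁻ʳ y (Sorted⇒All< (subst Sorted δ≡ (sorted δ)) (subst (HeadBelow k) δ≡ h))))

  step-successor : ∀ δ y → exps δ ≡ y ++ [ 0 ] → HeadBelow k (exps δ) → ∀ lam →
                   ltL lam (code (exps δ)) → Bracket lam ⊎ StepDown δ lam
  step-successor δ y δ≡ h lam lam< with ltL-trichotomy lam (code y)
  ... | inj₁ lam<y = inj₂ (mkOrd y sy , subst (ltL y) (sym δ≡) (ltL-properPrefix y 0 []) , hy , lam<y)
    where
    sy : Sorted y
    sy = init-sorted δ y 0 δ≡
    hy : HeadBelow k y
    hy = init-below δ y 0 δ≡ h
  ... | inj₂ y≤lam = inj₁ (y , init-sorted δ y 0 δ≡ , init-below δ y 0 δ≡ h , y≤ y≤lam ,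
                            subst (λ ds → ltL lam (code ds)) δ≡ lam<)
    where
    y≤ : lam ≡ code y ⊎ ltL (code y) lam → LeL (code y) lam
    y≤ (inj₁ refl) = inj₂ refl
    y≤ (inj₂ y<lam) = inj₁ y<lam

  step-limit : ∀ δ y t → exps δ ≡ y ++ [ suc t ] → HeadBelow k (exps δ) → ∀ lam → Sorted lam →
               ltL lam (code (exps δ)) → StepDown δ lam
  step-limit δ y t δ≡ h lam s lam< = approximant (encode-limit k ≤-refl y t sδ hδ)
    where
    sδ : Sorted (y ++ [ suc t ])
    sδ = subst Sorted δ≡ (sorted δ)
    hδ : HeadBelow k (y ++ [ suc t ])
    hδ = subst (HeadBelow k) δ≡ h
    t+1<k : suc t < k
    t+1<k with ++⁻ʳ y (Sorted⇒All< sδ hδ)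
    ... | t+1<k ∷ [] = t+1<k
    y' : ℕ → List ℕ
    y' N = y ++ replicate (suc N) t
    sy' : ∀ N → Sorted (y' N)
    sy' N = Sorted-++ y (replicate (suc N) t) (init-sorted δ y (suc t) δ≡) (Sorted-replicate (suc N) t)
      (All.map (λ t+1≤x → <⇒≤ t+1≤x) (Sorted-∷ʳ⇒All≥ y (suc t) sδ)) ≤-refl
    approximant : Limit k y t → StepDown δ lam
    approximant (P , eq , approx) with ltL-below-limit (Q ++ P) lam (m t + gap t) s lam<limit
      where
      open ≡-Reasoning
      lam<limit : ltL lam ((Q ++ P) ++ [ suc (m t + gap t) ])
      lam<limit = subst (ltL lam) (begin
        code (exps δ)                    ≡⟨ cong code δ≡ ⟩
        Q ++ encode k (y ++ [ suc t ])   ≡⟨ cong (Q ++_) eq ⟩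
        Q ++ P ++ [ m (suc t) ]          ≡⟨ sym (++-assoc Q P _) ⟩
        (Q ++ P) ++ [ m (suc t) ]        ≡⟨ cong (λ v → (Q ++ P) ++ [ v ]) (sym (m+gap t (<-trans (n<1+n t) t+1<k))) ⟩
        (Q ++ P) ++ [ suc (m t + gap t) ] ∎) lam<
    ... | N , below with approx N
    ...   | W , eqN = mkOrd (y' N) (sy' N) , y'<δ , hy' , lam<y'
      where
      open ≡-Reasoning
      y'<δ : ltL (y' N) (exps δ)
      y'<δ = subst (ltL (y' N)) (sym δ≡) (ltL-++⁺ y (inj₁ ≤-refl))
      hy' : HeadBelow k (y' N)
      hy' = HeadBelow-++ y _ (init-below δ y (suc t) δ≡ h) (<-trans (n<1+n t) t+1<k)
      lam<y' : ltL lam (code (y' N))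
      lam<y' = subst (ltL lam) (begin
        (Q ++ P) ++ replicate (c + N) (m t + gap t) ++ W  ≡⟨ ++-assoc Q P _ ⟩
        Q ++ P ++ replicate (c + N) (m t + gap t) ++ W    ≡⟨ cong (Q ++_) (sym eqN) ⟩
        code (y' N)                                        ∎)
        (below (c + N) (m<n+m N 1≤c) W)

  step-down : ∀ δ → HeadBelow k (exps δ) → ∀ lam → Sorted lam → LeL (code []) lam →
              ltL lam (code (exps δ)) → Bracket lam ⊎ StepDown δ lam
  step-down δ h lam s 0≤lam lam< with []⊎∷ʳ (exps δ)
  ... | inj₁ δ≡[] = ⊥-elim (ltL-irrefl (code [])
          (LeL-<-trans (code []) lam (code []) 0≤lam (subst (λ ds → ltL lam (code ds)) δ≡[] lam<)))
  ... | inj₂ (y , zero , δ≡) = step-successor δ y δ≡ h lam lam<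
  ... | inj₂ (y , suc t , δ≡) = inj₂ (step-limit δ y t δ≡ h lam s lam<)

  bracket : ∀ δ → Acc _<ₒ_ δ → HeadBelow k (exps δ) → ∀ lam → Sorted lam → LeL (code []) lam →
            ltL lam (code (exps δ)) → Bracket lam
  bracket δ (acc rs) h lam s 0≤lam lam< with step-down δ h lam s 0≤lam lam<
  ... | inj₁ found = found
  ... | inj₂ (δ' , δ'<δ , h' , lam<δ') = bracket δ' (rs δ'<δ) h' lam s 0≤lam lam<δ'

  Embedded-closed : ClosedInSup Embedded
  Embedded-closed lam (_ , (δ , δ< , refl) , lam<x) (β , β<lam) approach
    with approach (mkOrd [] []) (ltL⇒nonempty (exps β) (exps lam) β<lam)
  ... | _ , (δ₀ , δ₀< , refl) , _ , x₀≤lam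
    with bracket δ (<ₒ-wellFounded δ) (ltL⇒HeadBelow _ δ<) (exps lam) (sorted lam) 0≤lam lam<x
    where
    0≤lam : LeL (code []) (exps lam)
    0≤lam = LeL-trans (code []) _ (exps lam)
      (code-monoLe [] (exps δ₀) [] (sorted δ₀) tt (ltL⇒HeadBelow _ δ₀<) ([]-LeL (exps δ₀))) (≤ₒ⇒LeL x₀≤lam)
  ... | ys , sys , hys , inj₂ ys≡lam , _ = mkOrd ys sys , HeadBelow⇒ltL ys hys , exps-injective ys≡lam
  ... | ys , sys , hys , inj₁ ys<lam , lam<ys+1 with approach (embed (mkOrd ys sys)) ys<lam
  ...   | _ , (δ₂ , δ₂< , refl) , ys<δ₂ , x₂≤lam =
    ⊥-elim (ltL-irrefl (exps lam) (<-LeL-trans (exps lam) _ (exps lam) lam<ys+1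
      (LeL-trans _ (code (exps δ₂)) (exps lam) ys+1≤δ₂ (≤ₒ⇒LeL x₂≤lam))))
    where
    ys+1≤δ₂ : LeL (code (ys ++ [ 0 ])) (code (exps δ₂))
    ys+1≤δ₂ = code-monoLe (ys ++ [ 0 ]) (exps δ₂)
      (Sorted-++ ys [ 0 ] sys [-] (All.tabulate (λ _ → z≤n)) (s≤s z≤n)) (sorted δ₂)
      (HeadBelow-++ ys [ 0 ] hys 1≤k) (ltL⇒HeadBelow _ δ₂<)
      (ltL⇒∷ʳ0-LeL ys (exps δ₂) (code-mono⁻ ys (exps δ₂) sys (sorted δ₂) hys (ltL⇒HeadBelow _ δ₂<) ys<δ₂))

  CB-embed : ∀ δ → δ <ₒ ωpow k → CB (embed δ) ≡ m (CB δ)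
  CB-embed δ δ< = trans (lastL-++-≢[] Q _ (encode-≢[] k (exps δ) 1≤k))
    (encode-last k ≤-refl 1≤k (exps δ) (sorted δ) (ltL⇒HeadBelow _ δ<))

  embed-⊏θ : ∀ δ → embed δ ⊏ θ
  embed-⊏θ δ = tail⇒⊏θ (encode k (exps δ)) (Sorted-code (exps δ)) (All<⇒HeadBelow (encode<K (exps δ)))
    (≢[]⇒Admissible Q _ (encode-≢[] k (exps δ) 1≤k))

  embed-∈F : ∀ δ r → δ <ₒ ωpow k → RichHyp r k (exps δ) → F θ r (m (CB δ)) (embed δ)
  embed-∈F δ r δ< hyp = collapse , collapse-iso , inj₂ (embed-⊏θ δ) ,
    inj₁ (mt<K , (β⊏ω^K , CBβ≡) , subst (λ xs → r < pL xs) (sym β≡) (<-≤-trans r<count (count≤pL-shift Q μ sμ μ≢[])) , ancestors)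
    where
    ds : List ℕ
    ds = exps δ
    hds : HeadBelow k ds
    hds = ltL⇒HeadBelow ds δ<
    μ : List ℕ
    μ = encode k ds
    sμ : Sorted μ
    sμ = Sorted-encode k ≤-refl ds
    μ≢[] : μ ≢ []
    μ≢[] = encode-≢[] k ds 1≤k
    β : Ord
    β = collapse (embed δ)
    β≡ : exps β ≡ shift Q μ
    β≡ = collapse-tail (embed δ) μ refl (All<⇒HeadBelow (encode<K ds))
    last≡ : lastL μ ≡ m (CB δ)
    last≡ = encode-last k ≤-refl 1≤k ds (sorted δ) hds
    mt<K : m (CB δ) < K
    mt<K = subst (m (CB δ) <_) mk≡K (m-mono (lastL-< ds 1≤k (sorted δ) hds) ≤-refl)
    β⊏ω^K : β ⊏ ωpow K
    β⊏ω^K = <ω^⇒⊏ K 1≤K β (collapse-⊏ (embed δ) (embed-⊏θ δ))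
    CBβ≡ : CB β ≡ m (CB δ)
    CBβ≡ = trans (cong lastL β≡) (trans (lastL-shift Q μ sμ) last≡)
    rich : Rich r (lastL ds) (m k) μ
    rich = encode-rich k ≤-refl 1≤k ds r (sorted δ) hds hyp
    r<count : r < count (lastL μ) μ
    r<count = subst (λ v → r < count v μ) (sym last≡) (proj₂ rich)
    ancestors : ∀ β' → β ⊏ β' → β' ⊏ ωpow K → r < p β'
    ancestors β' (γ , 1≤γ , CBβ<γ , β'≡) β'⊏ω^K = subst (λ xs → r < pL xs) (sym β'≡)
      (subst (r <_) (sym (pL-addωL (exps β) γ 1≤γ (sorted β))) (s≤s (subst (r ≤_) (sym count≡)
        (proj₁ rich γ (<⇒≤ (subst (_< γ) CBβ≡ CBβ<γ)) γ<mk))))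
      where
      count≡ : count γ (exps β) ≡ count γ μ
      count≡ = trans (cong (count γ) β≡) (count-shift Q μ γ 1≤γ)
      γ<mk : γ < m k
      γ<mk with ++⁻ʳ (takeWhile (γ ≤?_) (exps β)) (subst (All (_< K)) β'≡
                 (Sorted⇒All< (sorted β') (ltL⇒HeadBelow _ (⊏ω^⇒< K 1≤K β' β'⊏ω^K))))
      ... | γ<K ∷ [] = subst (γ <_) (sym mk≡K) γ<K

extend : (k : ℕ) → (Fin k → ℕ) → ℕ → ℕ → ℕ
extend k l K j with j <? k
... | yes j<k = l (fromℕ< j<k)
... | no _ = K

extend-toℕ : ∀ k l K (i : Fin k) → extend k l K (toℕ i) ≡ l i
extend-toℕ k l K i with toℕ i <? k
... | yes i<k = cong l (fromℕ<-toℕ i i<k)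
... | no i≮k = ⊥-elim (i≮k (toℕ<n i))

extend-k : ∀ k l K → extend k l K k ≡ K
extend-k k l K with k <? k
... | yes k<k = ⊥-elim (<-irrefl refl k<k)
... | no _ = refl

extend-step : ∀ k (l : Fin k → ℕ) K → (∀ i j → i Fin.< j → l i < l j) → (∀ i → l i < K) →
              ∀ j → j < k → extend k l K j < extend k l K (suc j)
extend-step k l K l-mono l<K j j<k with j <? k | suc j <? k
... | yes p | yes q = l-mono (fromℕ< p) (fromℕ< q) (subst₂ _<_ (sym (toℕ-fromℕ< p)) (sym (toℕ-fromℕ< q)) ≤-refl)
... | yes p | no _ = l<K (fromℕ< p)
... | no j≮k | _ = ⊥-elim (j≮k j<k)

maximum : (k : ℕ) → (Fin k → ℕ) → ℕ
maximum zero f = 0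
maximum (suc k) f = f Fin.zero ⊔ maximum k (λ i → f (Fin.suc i))

≤-maximum : ∀ k f i → f i ≤ maximum k f
≤-maximum (suc k) f Fin.zero = m≤m⊔n _ _
≤-maximum (suc k) f (Fin.suc i) = ≤-trans (≤-maximum k (λ i → f (Fin.suc i)) i) (m≤n⊔m _ _)

module Construction (θ : Ord) (k : ℕ) (1≤k : 1 ≤ k)
    (l : Fin k → ℕ) (l-mono : ∀ i j → i Fin.< j → l i < l j) (l<K : ∀ i → l i < CB θ)
    (A : Fin k → Ord → Set) (A-large : ∀ i → L θ (l i) (A i))
    (Q : List ℕ) (θ≡ : exps θ ≡ Q ++ [ CB θ ]) (1≤K : 1 ≤ CB θ) where

  m : ℕ → ℕ
  m = extend k l (CB θ)
  R : ℕ
  R = maximum k (λ i → proj₁ (A-large i))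

  -- c exceeds every r of the sets A i, so each δ passes the richness test for each of them.
  open Embedding θ Q θ≡ 1≤K k 1≤k m (suc R) (s≤s z≤n) (extend-step k l (CB θ) l-mono l<K) (extend-k k l (CB θ)) public

  Embedded⊆⋃A : ∀ x → Embedded x → Σ (Fin k) λ i → A i x
  Embedded⊆⋃A x (δ , δ< , refl) = i , proj₂ (proj₂ (A-large i)) (embed δ) (subst (λ n → F θ r n (embed δ)) mt≡li
      (embed-∈F δ r δ< (λ j _ _ → s≤s (≤-trans (≤-maximum k (λ i → proj₁ (A-large i)) i) (m≤m+n R _)))))
    where
    t<k : CB δ < k
    t<k = lastL-< (exps δ) 1≤k (sorted δ) (ltL⇒HeadBelow _ δ<)
    i : Fin k
    i = fromℕ< t<k
    r : ℕ
    r = proj₁ (A-large i)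
    mt≡li : m (CB δ) ≡ l i
    mt≡li = trans (cong m (sym (toℕ-fromℕ< t<k))) (extend-toℕ k l (CB θ) i)

  decode-large : ∀ i (G : Ord → Set) → L θ (l i) G → L (ωpow k) (toℕ i) (image decode Embedded G)
  decode-large i G (r , G⊆ , F⊆G) = r , image⊆ , F⊆image
    where
    image⊆ : ∀ δ' → image decode Embedded G δ' → T= (ωpow k) (toℕ i) δ'
    image⊆ δ' (_ , (δ , δ< , refl) , Gx , refl) =
      subst (T= (ωpow k) (toℕ i)) (sym (decode-embed δ δ<)) (<ω^⇒⊏ k 1≤k δ δ< , CBδ≡)
      where
      CBδ≡ : CB δ ≡ toℕ i
      CBδ≡ = m-injective (lastL-< (exps δ) 1≤k (sorted δ) (ltL⇒HeadBelow _ δ<)) (toℕ<n i)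
        (trans (sym (CB-embed δ δ<)) (trans (proj₂ (G⊆ (embed δ) Gx)) (sym (extend-toℕ k l (CB θ) i))))
    F⊆image : ∀ δ → F (ωpow k) r (toℕ i) δ → image decode Embedded G δ
    F⊆image δ (π , π-iso , Tδ , πδ∈F) with Fω-digits k (toℕ i) r δ (toℕ<n i)
                                              (subst (Fω k r (toℕ i)) (OrdIso-T-ω^⇒id k 1≤k π π-iso δ Tδ) πδ∈F)
    ... | δ< , CBδ≡ , frequent = embed δ , (δ , δ< , refl) , F⊆G (embed δ) embed∈F , decode-embed δ δ<
      where
      embed∈F : F θ r (l i) (embed δ)
      embed∈F = subst (λ n → F θ r n (embed δ)) (trans (cong m CBδ≡) (extend-toℕ k l (CB θ) i))
        (embed-∈F δ r δ< (λ j CBδ≤j j<k → s≤s (≤-trans (frequent j (subst (_≤ j) CBδ≡ CBδ≤j) j<k) (m≤n+m _ R))))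

mainTheorem8 : (θ : Ord) (k : ℕ) → 1 ≤ k →
    (l : Fin k → ℕ) → (∀ i j → i Fin.< j → l i < l j) → (∀ i → l i < CB θ) →
    (A : Fin k → Ord → Set) → (∀ i → L θ (l i) (A i)) →
    Σ (Ord → Set) λ X →
      (∀ x → X x → Σ (Fin k) λ i → A i x) ×
      ClosedInSup X ×
      (Σ (Ord → Ord) λ π →
        OrdIso X (λ δ → δ <ₒ ωpow k) π ×
        (∀ i (G : Ord → Set) → L θ (l i) G → L (ωpow k) (toℕ i) (image π X G)))
mainTheorem8 θ k 1≤k l l-mono l<K A A-large with []⊎∷ʳ (exps θ)
... | inj₁ θ≡[] = ⊥-elim (n≮0 (subst (l (fromℕ< 1≤k) <_) (cong lastL θ≡[]) (l<K (fromℕ< 1≤k))))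
... | inj₂ (Q , K , θ≡) = Embedded , Embedded⊆⋃A , Embedded-closed , decode , decode-iso , decode-large
  where
  CBθ≡K : CB θ ≡ K
  CBθ≡K = trans (cong lastL θ≡) (lastL-++ Q K [])
  1≤K : 1 ≤ CB θ
  1≤K = ≤-trans (s≤s z≤n) (l<K (fromℕ< 1≤k))
  open Construction θ k 1≤k l l-mono l<K A A-large Q (trans θ≡ (cong (λ v → Q ++ [ v ]) (sym CBθ≡K))) 1≤K
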